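{- For every uniform matroid $\mathsf{U}_{k,n}$ with $n\ge k\ge 1$, $$Y_{\mathsf{U}_{k,n}}(t)=\sum_{i=0}^{\lfloor k/2\rfloor}\binom{n}{i}\binom{n-i-1}{n-k}t^i+\sum_{i=0}^{\lfloor (k-1)/2\rfloor}\binom{n}{i}\binom{n-i-1}{n-k}t^{k-i}.$$
   Context: $\mathsf{U}_{k,n}$ is the uniform matroid of rank $k$ on ground set $[n]$ whose bases are all $k$-subsets of $[n]$. For a matroid $\mathsf{M}$ on $E$ with rank function $\mathrm{rk}$, $\mathcal{L}(\mathsf{M})$ is its lattice of flats, $\mathsf{M}|_F$ the restriction and $\mathsf{M}/F$ the contraction; $\mathrm{rk}(\mathsf{M}|_F)=\mathrm{rk}(F)$, $\mathrm{rk}(\mathsf{M}/F)=\mathrm{rk}(\mathsf{M})-\mathrm{rk}(F)$. For a loopless matroid $\mathsf{M}$, $\mu_{\mathsf{M}}$ is the value $\mu(\emptyset,E)$ of the Möbius function of $\mathcal{L}(\mathsf{M})$ (so $\mu_{\mathsf{M}}=1$ if $\mathrm{rk}(\mathsf{M})=0$), and $\chi_{\mathsf{M}}(t)=\sum_{F\in\mathcal{L}(\mathsf{M})}\mu_{\mathsf{M}|_F}t^{\mathrm{rk}(\mathsf{M}/F)}$ is its characteristic polynomial. The inverse Kazhdan–Lusztig polynomial $Q_{\mathsf{M}}(t)$ of a loopless matroid is the unique assignment of polynomials such that $Q_{\mathsf{M}}(t)=1$ if $\mathrm{rk}(\mathsf{M})=0$, $\deg Q_{\mathsf{M}}<\mathrm{rk}(\mathsf{M})/2$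 if $\mathrm{rk}(\mathsf{M})>0$, and $(-t)^{\mathrm{rk}(\mathsf{M})}Q_{\mathsf{M}}(t^{ -1})=\sum_{F\in\mathcal{L}(\mathsf{M})}(-1)^{\mathrm{rk}(F)}Q_{\mathsf{M}|_F}(t)\,t^{\mathrm{rk}(\mathsf{M}/F)}\chi_{\mathsf{M}/F}(t^{ -1})$. For a loopless matroid $\mathsf{M}$ define $\hat Y_{\mathsf{M}}(t)=\sum_{F\in\mathcal{L}(\mathsf{M})}(-1)^{\mathrm{rk}(F)}Q_{\mathsf{M}|_F}(t)\,t^{\mathrm{rk}(\mathsf{M}/F)}\mu_{\mathsf{M}/F}$ and the inverse $Z$-polynomial $Y_{\mathsf{M}}(t)=(-1)^{\mathrm{rk}(\mathsf{M})}\hat Y_{\mathsf{M}}(t)$; if $\mathsf{M}$ has loops, $Y_{\mathsf{M}}(t):=Y_{\mathsf{M}'}(t)$ where $\mathsf{M}'$ is $\mathsf{M}$ with all loops deleted. -}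

module Defs where

open import Data.Bool using (Bool; true; false; if_then_else_; _∧_; not)
open import Data.Nat as ℕ using (ℕ; zero; suc; _∸_; _≤_; _<_; _<ᵇ_; _≡ᵇ_; ⌊_/2⌋)
  renaming (_+_ to _+ℕ_; _*_ to _*ℕ_)
open import Data.Nat.Combinatorics using (_C_)
open import Data.Integer as ℤ using (ℤ; +_; -_; _+_; _*_)
open import Data.List as L using (List; []; _∷_; _++_; map; foldr; filterᵇ; upTo; replicate; allFin)
open import Data.Vec using (Vec; []; _∷_; lookup)
open import Data.Vec.Properties using (≡-dec)
open import Data.Fin using (Fin)
open import Data.Fin.Subset using (Subset; _∪_; _∩_; _─_; ⁅_⁆; ∣_∣; ⊥; ⊤; _⊆_; _∈_)
open import Data.Fin.Subset.Properties using (_⊆?_; _⊂?_)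
open import Data.Product using (_×_)
open import Relation.Nullary.Decidable using (⌊_⌋)
open import Relation.Binary.PropositionalEquality using (_≡_)
import Data.Bool.Properties as BoolP

-- Polynomials with integer coefficients: coefficient lists, lowest
-- degree first.  Equality is coefficientwise (so trailing zeros are
-- irrelevant).

Poly : Set
Poly = List ℤ

coeff : Poly → ℕ → ℤ
coeff []       _       = + 0
coeff (c ∷ _)  zero    = c
coeff (_ ∷ cs) (suc i) = coeff cs i

infix 4 _≈ₚ_
_≈ₚ_ : Poly → Poly → Set
p ≈ₚ q = ∀ i → coeff p i ≡ coeff q i

infixl 6 _+ₚ_
_+ₚ_ : Poly → Poly → Poly
[]       +ₚ q        = q
(a ∷ p)  +ₚ []       = a ∷ p
(a ∷ p)  +ₚ (b ∷ q)  = (a + b) ∷ (p +ₚ q)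

scale : ℤ → Poly → Poly
scale c = map (c *_)

infixl 7 _*ₚ_
_*ₚ_ : Poly → Poly → Poly
[]      *ₚ q = []
(a ∷ p) *ₚ q = scale a q +ₚ (+ 0 ∷ (p *ₚ q))

monomial : ℤ → ℕ → Poly
monomial c d = replicate d (+ 0) ++ (c ∷ [])

oneₚ : Poly
oneₚ = + 1 ∷ []

sumₚ : List Poly → Poly
sumₚ = foldr _+ₚ_ []

sumℤ : List ℤ → ℤ
sumℤ = foldr _+_ (+ 0)

-- t^d P(t^{-1})   (a polynomial whenever deg P ≤ d)
rev : ℕ → Poly → Poly
rev d p = map (λ j → coeff p (d ∸ j)) (upTo (suc d))

sgn : ℕ → ℤ
sgn zero    = + 1
sgn (suc m) = - sgn m

allSubsets : (N : ℕ) → List (Subset N)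
allSubsets zero    = [] ∷ []
allSubsets (suc N) = map (true ∷_) (allSubsets N) ++ map (false ∷_) (allSubsets N)

_⊆ᵇ_ : ∀ {N} → Subset N → Subset N → Bool
A ⊆ᵇ B = ⌊ A ⊆? B ⌋

_⊂ᵇ_ : ∀ {N} → Subset N → Subset N → Bool
A ⊂ᵇ B = ⌊ A ⊂? B ⌋

_==ᵇ_ : ∀ {N} → Subset N → Subset N → Bool
A ==ᵇ B = ⌊ ≡-dec BoolP._≟_ A B ⌋

-- Matroids on a ground set E ⊆ Fin N, given by a rank function.
-- Only the values of rk on subsets of E are meaningful.

record RawMatroid (N : ℕ) : Set where
  constructor mkRaw
  field
    E  : Subset N
    rk : Subset N → ℕ
open RawMatroid public

record IsMatroid {N : ℕ} (M : RawMatroid N) : Set where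
  field
    R1 : ∀ A → A ⊆ E M → rk M A ≤ ∣ A ∣
    R2 : ∀ A B → A ⊆ B → B ⊆ E M → rk M A ≤ rk M B
    R3 : ∀ A B → A ⊆ E M → B ⊆ E M →
         rk M (A ∪ B) +ℕ rk M (A ∩ B) ≤ rk M A +ℕ rk M B

Loopless : ∀ {N} → RawMatroid N → Set
Loopless M = ∀ e → e ∈ E M → rk M ⁅ e ⁆ ≡ 1

rank : ∀ {N} → RawMatroid N → ℕ
rank M = rk M (E M)

restrict : ∀ {N} → RawMatroid N → Subset N → RawMatroid N
restrict M F = mkRaw F (rk M)

contract : ∀ {N} → RawMatroid N → Subset N → RawMatroid N
contract M F = mkRaw (E M ─ F) (λ A → rk M (A ∪ F) ∸ rk M F)

allᵇ : {A : Set} → (A → Bool) → List A → Bool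
allᵇ p = foldr (λ x b → p x ∧ b) true

isFlat : ∀ {N} → RawMatroid N → Subset N → Bool
isFlat {N} M F =
  (F ⊆ᵇ E M) ∧
  allᵇ (λ e → if lookup (E M) e ∧ not (lookup F e)
               then rk M F <ᵇ rk M (F ∪ ⁅ e ⁆) else true)
      (allFin N)

flats : ∀ {N} → RawMatroid N → List (Subset N)
flats {N} M = filterᵇ (isFlat M) (allSubsets N)

-- The fuel argument bounds the length of chains; suc N always suffices.
möb : ∀ {N} → RawMatroid N → ℕ → Subset N → Subset N → ℤ
möb M zero    F G = + 0
möb M (suc f) F G =
  if G ==ᵇ F then + 1
  else - sumℤ (map (möb M f F)
                   (filterᵇ (λ H → (F ⊆ᵇ H) ∧ (H ⊂ᵇ G)) (flats M)))

μ : ∀ {N} → RawMatroid N → ℤ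
μ {N} M = möb M (suc N) ⊥ (E M)

χ : ∀ {N} → RawMatroid N → Poly
χ M = sumₚ (map (λ F → monomial (μ (restrict M F)) (rank (contract M F))) (flats M))

QRHS : (∀ {N} → RawMatroid N → Poly) → ∀ {N} → RawMatroid N → Poly
QRHS Q M = sumₚ (map (λ F → scale (sgn (rk M F))
                          (Q (restrict M F) *ₚ rev (rank (contract M F)) (χ (contract M F))))
                     (flats M))

record IsInverseKL (Q : ∀ {N} → RawMatroid N → Poly) : Set where
  field
    rank0 : ∀ {N} (M : RawMatroid N) → IsMatroid M → Loopless M →
            rank M ≡ 0 → Q M ≈ₚ oneₚ
    degree : ∀ {N} (M : RawMatroid N) → IsMatroid M → Loopless M →
             0 < rank M → ∀ i → rank M ≤ 2 *ℕ i → coeff (Q M) i ≡ + 0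
    equation : ∀ {N} (M : RawMatroid N) → IsMatroid M → Loopless M →
               scale (sgn (rank M)) (rev (rank M) (Q M)) ≈ₚ QRHS Q M

Ŷ : (∀ {N} → RawMatroid N → Poly) → ∀ {N} → RawMatroid N → Poly
Ŷ Q M = sumₚ (map (λ F → scale (sgn (rk M F))
                        (Q (restrict M F) *ₚ monomial (μ (contract M F)) (rank (contract M F))))
                   (flats M))

Y : (∀ {N} → RawMatroid N → Poly) → ∀ {N} → RawMatroid N → Poly
Y Q M = scale (sgn (rank M)) (Ŷ Q M)

rankFromBases : ∀ {N} → List (Subset N) → Subset N → ℕ
rankFromBases Bs A = foldr (λ B m → ∣ A ∩ B ∣ ℕ.⊔ m) 0 Bs

uniformBases : ℕ → (n : ℕ) → List (Subset n)
uniformBases k n = filterᵇ (λ B → ∣ B ∣ ≡ᵇ k) (allSubsets n)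

U : ℕ → (n : ℕ) → RawMatroid n
U k n = mkRaw ⊤ (rankFromBases (uniformBases k n))

binomTerm : ℕ → ℕ → ℕ → ℤ
binomTerm k n i = + ((n C i) *ℕ ((n ∸ i ∸ 1) C (n ∸ k)))

formula : ℕ → ℕ → Poly
formula k n =
  sumₚ (map (λ i → monomial (binomTerm k n i) i) (upTo (suc ⌊ k /2⌋)))
  +ₚ sumₚ (map (λ i → monomial (binomTerm k n i) (k ∸ i)) (upTo (suc ⌊ (k ∸ 1) /2⌋)))

{-# OPTIONS --safe #-}
module Submission where

-- A uniform matroid of rank r on m elements has as flats its ground set and the C(m,j)
-- subsets of each size j < r; the restriction to such a flat is Boolean and the contraction
-- is uniform of rank r - j on m - j elements. Every sum over flats in the definitions of
-- μ, χ, Q and Ŷ thus collapses to a sum over j weighted by C(m,j), which the alternating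
-- partial sums Σ_{j≤s} (-1)^j C(m+1,j) = (-1)^s C(m,s) evaluate. This gives
-- μ(U_{r,m}) = (-1)^r C(m-1,r-1) and Q = 1 for Boolean matroids, and comparing the
-- coefficients of t^d, 2d < r, in the defining equation of Q gives Q_{U_{r,m}} explicitly.
-- In Y_{U_{k,n}} only the flats of size k - i contribute to t^i, namely
-- C(n,k-i) C(n-k+i-1,i-1) for 1 ≤ i ≤ k; for 2i < k the coefficient of Q_{U_{k,n}} is the
-- paper's binomial term minus exactly this contribution, which leaves the two sums.

open import Defs
open import Data.Bool using (Bool; true; false; if_then_else_; _∧_; _∨_; not; T)
open import Data.Bool.Properties using (T-≡; ∧-zeroʳ)
import Data.Bool.Properties as Bool
open import Data.Fin using (Fin; zero; suc)
open import Data.Fin.Subset using (Subset; _∪_; _∩_; _─_; ⁅_⁆; ∣_∣; ⊥; ⊤; _⊆_; _⊂_; _∈_; _∉_; inside; outside)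
open import Data.Fin.Subset.Properties
  using (_⊆?_; _⊂?_; drop-∷-⊆; drop-there; ⊆-refl; ⊆-trans; ⊥⊆; ∣⊥∣≡0; ∣⊤∣≡n; ∣p∣≤n; p⊆q⇒∣p∣≤∣q∣; p⊂q⇒∣p∣<∣q∣;
         x∈p∪q⁻; x∈⁅y⁆⇒x≡y; ∣⁅x⁆∣≡1; p─q⊆p; p∩q⊆p; p∩q⊆q; ∣p∩q∣≤∣p∣⊓∣q∣)
open import Data.Integer as ℤ using (ℤ; +_; -_; _+_; _*_; _-_)
import Data.Integer.Properties as ℤ
open import Data.Integer.Tactic.RingSolver using (solve-∀)
open import Data.List using ([]; _∷_; _++_; map; filterᵇ; upTo; applyUpTo; allFin)
open import Data.List.Properties using (map-++; map-applyUpTo)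
import Data.List.Membership.Propositional as List
open import Data.List.Membership.Propositional.Properties using (∈-allFin; ∈-map⁺; ∈-++⁺ˡ; ∈-++⁺ʳ; ∈-filter⁺; ∈-filter⁻)
open import Data.List.Relation.Unary.Any using (here; there)
open import Data.Nat as ℕ using (ℕ; zero; suc; _∸_; _≤_; _<_; z≤n; s≤s; _<ᵇ_; _≡ᵇ_; _⊓_; _!; ⌊_/2⌋)
  renaming (_+_ to _+ℕ_; _*_ to _*ℕ_)
import Data.Nat.Properties as ℕ
open import Data.Nat.Combinatorics
  using (_C_; nCk+nC[k+1]≡[n+1]C[k+1]; nCk≡nC[n∸k]; nCn≡1; k>n⇒nCk≡0; nCk≡n!/k![n-k]!; k![n∸k]!∣n!)
open import Data.Nat.DivMod using (m/n*n≡m)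
open import Data.Nat.Induction using (<-rec)
import Data.Nat.Tactic.RingSolver as ℕSolver
open import Data.Product using (_×_; _,_; ∃; proj₁; proj₂)
open import Data.Sum using (_⊎_; inj₁; inj₂)
open import Data.Vec using ([]; _∷_; lookup; here; there)
open import Data.Vec.Properties using (≡-dec; []=⇒lookup; lookup⇒[]=)
open import Function using (id; _∘_; Equivalence)
open import Relation.Binary.Definitions using (tri<; tri≈; tri>)
open import Relation.Binary.PropositionalEquality
open import Relation.Nullary using (Dec; yes; no; ¬_; contradiction)
open import Relation.Nullary.Decidable using (⌊_⌋; T?; toWitness; fromWitness; ⌊⌋-map′)

-- Finite sums and signs

Σ< : ℕ → (ℕ → ℤ) → ℤ
Σ< zero    f = + 0
Σ< (suc n) f = Σ< n f + f n

Σ<-cong : ∀ n {f g : ℕ → ℤ} → (∀ j → j < n → f j ≡ g j) → Σ< n f ≡ Σ< n g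
Σ<-cong zero    eq = refl
Σ<-cong (suc n) eq = cong₂ _+_ (Σ<-cong n (λ j j<n → eq j (ℕ.m<n⇒m<1+n j<n))) (eq n ℕ.≤-refl)

Σ<-zero : ∀ n {f : ℕ → ℤ} → (∀ j → j < n → f j ≡ + 0) → Σ< n f ≡ + 0
Σ<-zero zero    eq = refl
Σ<-zero (suc n) eq = cong₂ _+_ (Σ<-zero n (λ j j<n → eq j (ℕ.m<n⇒m<1+n j<n))) (eq n ℕ.≤-refl)

Σ<-+ : ∀ n (f g : ℕ → ℤ) → Σ< n (λ j → f j + g j) ≡ Σ< n f + Σ< n g
Σ<-+ zero    f g = refl
Σ<-+ (suc n) f g = trans (cong (_+ (f n + g n)) (Σ<-+ n f g)) (swap (Σ< n f) (Σ< n g) (f n) (g n))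
  where
  swap : ∀ a b c d → a + b + (c + d) ≡ a + c + (b + d)
  swap = solve-∀

Σ<-*ˡ : ∀ n c (f : ℕ → ℤ) → Σ< n (λ j → c * f j) ≡ c * Σ< n f
Σ<-*ˡ zero    c f = sym (ℤ.*-zeroʳ c)
Σ<-*ˡ (suc n) c f = trans (cong (_+ c * f n) (Σ<-*ˡ n c f)) (sym (ℤ.*-distribˡ-+ c (Σ< n f) (f n)))

Σ<-split : ∀ a b (f : ℕ → ℤ) → Σ< (a +ℕ b) f ≡ Σ< a f + Σ< b (λ t → f (a +ℕ t))
Σ<-split a zero    f = trans (cong (λ n → Σ< n f) (ℕ.+-identityʳ a)) (sym (ℤ.+-identityʳ _))
Σ<-split a (suc b) f = begin
  Σ< (a +ℕ suc b) f                                           ≡⟨ cong (λ n → Σ< n f) (ℕ.+-suc a b) ⟩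
  Σ< (a +ℕ b) f + f (a +ℕ b)                                  ≡⟨ cong (_+ f (a +ℕ b)) (Σ<-split a b f) ⟩
  Σ< a f + Σ< b (λ t → f (a +ℕ t)) + f (a +ℕ b)               ≡⟨ ℤ.+-assoc (Σ< a f) _ _ ⟩
  Σ< a f + (Σ< b (λ t → f (a +ℕ t)) + f (a +ℕ b))             ∎
  where open ≡-Reasoning

Σ<-suc : ∀ n (f : ℕ → ℤ) → Σ< (suc n) f ≡ f 0 + Σ< n (f ∘ suc)
Σ<-suc n f = trans (Σ<-split 1 n f) (cong (_+ Σ< n (f ∘ suc)) (ℤ.+-identityˡ (f 0)))

Σ<-truncate : ∀ r n {f : ℕ → ℤ} → r ≤ n → (∀ j → r ≤ j → j < n → f j ≡ + 0) → Σ< n f ≡ Σ< r f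
Σ<-truncate r n {f} r≤n vanish = begin
  Σ< n f                                        ≡⟨ cong (λ n → Σ< n f) (ℕ.m+[n∸m]≡n r≤n) ⟨
  Σ< (r +ℕ (n ∸ r)) f                           ≡⟨ Σ<-split r (n ∸ r) f ⟩
  Σ< r f + Σ< (n ∸ r) (λ t → f (r +ℕ t))        ≡⟨ cong (λ z → Σ< r f + z) (Σ<-zero (n ∸ r) tail-vanishes) ⟩
  Σ< r f + + 0                                  ≡⟨ ℤ.+-identityʳ _ ⟩
  Σ< r f                                        ∎
  where
  open ≡-Reasoning
  tail-vanishes : ∀ t → t < n ∸ r → f (r +ℕ t) ≡ + 0
  tail-vanishes t t<n∸r = vanish (r +ℕ t) (ℕ.m≤m+n r t) (subst (r +ℕ t <_) (ℕ.m+[n∸m]≡n r≤n) (ℕ.+-monoʳ-< r t<n∸r))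

Σ<-single : ∀ n p (f : ℕ → ℤ) → p < n → (∀ j → j < n → j ≢ p → f j ≡ + 0) → Σ< n f ≡ f p
Σ<-single (suc n) p f p<1+n vanish with p ℕ.≟ n
... | yes refl = trans (cong (_+ f p) (Σ<-zero p (λ j j<p → vanish j (ℕ.m<n⇒m<1+n j<p) (ℕ.<⇒≢ j<p))))
                       (ℤ.+-identityˡ (f p))
... | no p≢n = trans (cong₂ _+_ (Σ<-single n p f (ℕ.≤∧≢⇒< (ℕ.≤-pred p<1+n) p≢n) (λ j j<n → vanish j (ℕ.m<n⇒m<1+n j<n)))
                                (vanish n ℕ.≤-refl (p≢n ∘ sym)))
                     (ℤ.+-identityʳ (f p))

sumℤ-upTo : ∀ (f : ℕ → ℤ) n → sumℤ (map f (upTo n)) ≡ Σ< n f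
sumℤ-upTo f n = trans (cong sumℤ (map-applyUpTo id f n)) (sumℤ-applyUpTo f n)
  where
  sumℤ-applyUpTo : ∀ (f : ℕ → ℤ) n → sumℤ (applyUpTo f n) ≡ Σ< n f
  sumℤ-applyUpTo f zero    = refl
  sumℤ-applyUpTo f (suc n) = trans (cong (λ z → f 0 + z) (sumℤ-applyUpTo (f ∘ suc) n)) (sym (Σ<-suc n f))

+-cancelˡ : ∀ a {x y} → a + x ≡ a + y → x ≡ y
+-cancelˡ a {x} {y} a+x≡a+y = trans (sym (-a+[a+z]≡z a x)) (trans (cong (λ z → - a + z) a+x≡a+y) (-a+[a+z]≡z a y))
  where
  -a+[a+z]≡z : ∀ a z → - a + (a + z) ≡ z
  -a+[a+z]≡z = solve-∀

sgn-+ : ∀ m n → sgn (m +ℕ n) ≡ sgn m * sgn n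
sgn-+ zero    n = sym (ℤ.*-identityˡ (sgn n))
sgn-+ (suc m) n = trans (cong -_ (sgn-+ m n)) (ℤ.neg-distribˡ-* (sgn m) (sgn n))

sgn*sgn≡1 : ∀ m → sgn m * sgn m ≡ + 1
sgn*sgn≡1 zero    = refl
sgn*sgn≡1 (suc m) = trans (neg*neg (sgn m)) (sgn*sgn≡1 m)
  where
  neg*neg : ∀ x → (- x) * (- x) ≡ x * x
  neg*neg = solve-∀

sgn*sgn*x≡x : ∀ m x → sgn m * (sgn m * x) ≡ x
sgn*sgn*x≡x m x = trans (sym (ℤ.*-assoc (sgn m) (sgn m) x)) (trans (cong (_* x) (sgn*sgn≡1 m)) (ℤ.*-identityˡ x))

+-sgn-cancelˡ : ∀ a r x y → a + sgn r * x ≡ a + sgn r * y → x ≡ y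
+-sgn-cancelˡ a r x y eq = begin
  x                       ≡⟨ sgn*sgn*x≡x r x ⟨
  sgn r * (sgn r * x)     ≡⟨ cong (sgn r *_) (+-cancelˡ a eq) ⟩
  sgn r * (sgn r * y)     ≡⟨ sgn*sgn*x≡x r y ⟩
  y                       ∎
  where open ≡-Reasoning

-- Binomial coefficients

nCk*[k!*[n∸k]!]≡n! : ∀ {n k} → k ≤ n → (n C k) *ℕ (k ! *ℕ (n ∸ k) !) ≡ n !
nCk*[k!*[n∸k]!]≡n! {n} {k} k≤n =
  trans (cong (_*ℕ (k ! *ℕ (n ∸ k) !)) (nCk≡n!/k![n-k]! k≤n)) (m/n*n≡m (k![n∸k]!∣n! k≤n))
  where instance _ = k ℕ.!* (n ∸ k) !≢0

mCj*[m∸j]Cd≡mCd*[m∸d]Cj : ∀ {m} j d → j +ℕ d ≤ m → (m C j) *ℕ ((m ∸ j) C d) ≡ (m C d) *ℕ ((m ∸ d) C j)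
mCj*[m∸j]Cd≡mCd*[m∸d]Cj {m} j d j+d≤m = ℕ.*-cancelʳ-≡ _ _ (j ! *ℕ (d ! *ℕ (m ∸ j ∸ d) !)) (begin
  ((m C j) *ℕ ((m ∸ j) C d)) *ℕ (j ! *ℕ (d ! *ℕ (m ∸ j ∸ d) !))  ≡⟨ C*C*factorials j d j+d≤m ⟩
  m !                                                         ≡⟨ C*C*factorials d j (subst (_≤ m) (ℕ.+-comm j d) j+d≤m) ⟨
  ((m C d) *ℕ ((m ∸ d) C j)) *ℕ (d ! *ℕ (j ! *ℕ (m ∸ d ∸ j) !))  ≡⟨ cong (_*ℕ_ ((m C d) *ℕ ((m ∸ d) C j))) factorials-swap ⟩
  ((m C d) *ℕ ((m ∸ d) C j)) *ℕ (j ! *ℕ (d ! *ℕ (m ∸ j ∸ d) !))  ∎)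
  where
  open ≡-Reasoning
  C*C*factorials : ∀ j d → j +ℕ d ≤ m → ((m C j) *ℕ ((m ∸ j) C d)) *ℕ (j ! *ℕ (d ! *ℕ (m ∸ j ∸ d) !)) ≡ m !
  C*C*factorials j d j+d≤m = begin
    ((m C j) *ℕ ((m ∸ j) C d)) *ℕ (j ! *ℕ (d ! *ℕ (m ∸ j ∸ d) !))  ≡⟨ regroup (m C j) ((m ∸ j) C d) (j !) _ ⟩
    (m C j) *ℕ (j ! *ℕ (((m ∸ j) C d) *ℕ (d ! *ℕ (m ∸ j ∸ d) !)))  ≡⟨ cong (λ x → (m C j) *ℕ (j ! *ℕ x)) (nCk*[k!*[n∸k]!]≡n! d≤m∸j) ⟩
    (m C j) *ℕ (j ! *ℕ (m ∸ j) !)                                  ≡⟨ nCk*[k!*[n∸k]!]≡n! (ℕ.m+n≤o⇒m≤o j j+d≤m) ⟩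
    m !                                                             ∎
    where
    d≤m∸j : d ≤ m ∸ j
    d≤m∸j = ℕ.m+n≤o⇒m≤o∸n d (subst (_≤ m) (ℕ.+-comm j d) j+d≤m)
    regroup : ∀ a b x y → (a *ℕ b) *ℕ (x *ℕ y) ≡ a *ℕ (x *ℕ (b *ℕ y))
    regroup = ℕSolver.solve-∀
  instance _ = ℕ.m*n≢0 (j !) (d ! *ℕ (m ∸ j ∸ d) !) {{j ℕ.!≢0}} {{d ℕ.!* (m ∸ j ∸ d) !≢0}}
  m∸d∸j≡m∸j∸d : m ∸ d ∸ j ≡ m ∸ j ∸ d
  m∸d∸j≡m∸j∸d = trans (ℕ.∸-+-assoc m d j) (trans (cong (m ∸_) (ℕ.+-comm d j)) (sym (ℕ.∸-+-assoc m j d)))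
  exchange : ∀ x y z → x *ℕ (y *ℕ z) ≡ y *ℕ (x *ℕ z)
  exchange = ℕSolver.solve-∀
  factorials-swap : d ! *ℕ (j ! *ℕ (m ∸ d ∸ j) !) ≡ j ! *ℕ (d ! *ℕ (m ∸ j ∸ d) !)
  factorials-swap = trans (cong (λ z → d ! *ℕ (j ! *ℕ z !)) m∸d∸j≡m∸j∸d) (exchange (d !) (j !) _)

C[a+b]a≡C[a+b]b : ∀ a b → (a +ℕ b) C a ≡ (a +ℕ b) C b
C[a+b]a≡C[a+b]b a b = trans (nCk≡nC[n∸k] (ℕ.m≤m+n a b)) (cong ((a +ℕ b) C_) (ℕ.m+n∸m≡n a b))

Σ-alternating-C : ∀ n s → Σ< (suc s) (λ j → sgn j * + (suc n C j)) ≡ sgn s * + (n C s)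
Σ-alternating-C n zero    = refl
Σ-alternating-C n (suc s) = begin
  Σ< (suc s) (λ j → sgn j * + (suc n C j)) + sgn (suc s) * + (suc n C suc s)
    ≡⟨ cong₂ _+_ (Σ-alternating-C n s) (cong (λ c → - sgn s * + c) (sym (nCk+nC[k+1]≡[n+1]C[k+1] n s))) ⟩
  sgn s * + (n C s) + - sgn s * + (n C s +ℕ n C suc s)
    ≡⟨ cong (λ c → sgn s * + (n C s) + - sgn s * c) (ℤ.pos-+ (n C s) (n C suc s)) ⟩
  sgn s * + (n C s) + - sgn s * (+ (n C s) + + (n C suc s))
    ≡⟨ telescope (sgn s) (+ (n C s)) (+ (n C suc s)) ⟩
  sgn (suc s) * + (n C suc s)
    ∎
  where
  open ≡-Reasoning
  telescope : ∀ x a b → x * a + - x * (a + b) ≡ - x * b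
  telescope = solve-∀

Σ-pascal : ∀ g (h : ℕ → ℤ) →
           Σ< (suc g) (λ j → + (g C j) * h (suc j)) + Σ< (suc g) (λ j → + (g C j) * h j)
           ≡ Σ< (suc (suc g)) (λ j → + (suc g C j) * h j)
Σ-pascal g h = begin
  Σ< (suc g) (λ j → + (g C j) * h (suc j)) + Σ< (suc g) (λ j → + (g C j) * h j)
    ≡⟨ cong (λ z → Σ< (suc g) (λ j → + (g C j) * h (suc j)) + z) (Σ<-suc g (λ j → + (g C j) * h j)) ⟩
  Σ< (suc g) (λ j → + (g C j) * h (suc j)) + (+ 1 * h 0 + Σ< g (λ j → + (g C suc j) * h (suc j)))
    ≡⟨ cong (λ z → Σ< (suc g) (λ j → + (g C j) * h (suc j)) + (+ 1 * h 0 + z)) (sym last-term-vanishes) ⟩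
  Σ< (suc g) (λ j → + (g C j) * h (suc j)) + (+ 1 * h 0 + Σ< (suc g) (λ j → + (g C suc j) * h (suc j)))
    ≡⟨ rearrange (Σ< (suc g) (λ j → + (g C j) * h (suc j))) (+ 1 * h 0) (Σ< (suc g) (λ j → + (g C suc j) * h (suc j))) ⟩
  + 1 * h 0 + (Σ< (suc g) (λ j → + (g C j) * h (suc j)) + Σ< (suc g) (λ j → + (g C suc j) * h (suc j)))
    ≡⟨ cong (λ z → + 1 * h 0 + z) (sym (Σ<-+ (suc g) _ _)) ⟩
  + 1 * h 0 + Σ< (suc g) (λ j → + (g C j) * h (suc j) + + (g C suc j) * h (suc j))
    ≡⟨ cong (λ z → + 1 * h 0 + z) (Σ<-cong (suc g) (λ j _ → pascal j)) ⟩
  + 1 * h 0 + Σ< (suc g) (λ j → + (suc g C suc j) * h (suc j))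
    ≡⟨ Σ<-suc (suc g) (λ j → + (suc g C j) * h j) ⟨
  Σ< (suc (suc g)) (λ j → + (suc g C j) * h j)
    ∎
  where
  open ≡-Reasoning
  last-term-vanishes : Σ< (suc g) (λ j → + (g C suc j) * h (suc j)) ≡ Σ< g (λ j → + (g C suc j) * h (suc j))
  last-term-vanishes = trans (cong (λ c → Σ< g (λ j → + (g C suc j) * h (suc j)) + + c * h (suc g))
                                   (k>n⇒nCk≡0 (ℕ.n<1+n g)))
                             (ℤ.+-identityʳ _)
  rearrange : ∀ a b c → a + (b + c) ≡ b + (a + c)
  rearrange = solve-∀
  pascal : ∀ j → + (g C j) * h (suc j) + + (g C suc j) * h (suc j) ≡ + (suc g C suc j) * h (suc j)
  pascal j = trans (sym (ℤ.*-distribʳ-+ (h (suc j)) (+ (g C j)) (+ (g C suc j))))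
                   (cong (λ c → c * h (suc j)) (trans (sym (ℤ.pos-+ (g C j) (g C suc j)))
                                                     (cong +_ (nCk+nC[k+1]≡[n+1]C[k+1] g j))))

-- Coefficients of polynomials

coeff-+ₚ : ∀ p q i → coeff (p +ₚ q) i ≡ coeff p i + coeff q i
coeff-+ₚ []      q       i       = sym (ℤ.+-identityˡ _)
coeff-+ₚ (a ∷ p) []      i       = sym (ℤ.+-identityʳ _)
coeff-+ₚ (a ∷ p) (b ∷ q) zero    = refl
coeff-+ₚ (a ∷ p) (b ∷ q) (suc i) = coeff-+ₚ p q i

coeff-scale : ∀ c p i → coeff (scale c p) i ≡ c * coeff p i
coeff-scale c []      i       = sym (ℤ.*-zeroʳ c)
coeff-scale c (a ∷ p) zero    = refl
coeff-scale c (a ∷ p) (suc i) = coeff-scale c p i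

coeff-sumₚ : ∀ {X : Set} (f : X → Poly) xs i →
             coeff (sumₚ (map f xs)) i ≡ sumℤ (map (λ x → coeff (f x) i) xs)
coeff-sumₚ f []       i = refl
coeff-sumₚ f (x ∷ xs) i = trans (coeff-+ₚ (f x) _ i) (cong (λ z → coeff (f x) i + z) (coeff-sumₚ f xs i))

coeff-monomial-≡ : ∀ c d → coeff (monomial c d) d ≡ c
coeff-monomial-≡ c zero    = refl
coeff-monomial-≡ c (suc d) = coeff-monomial-≡ c d

coeff-monomial-≢ : ∀ c {d i} → i ≢ d → coeff (monomial c d) i ≡ + 0
coeff-monomial-≢ c {zero}  {zero}  i≢d = contradiction refl i≢d
coeff-monomial-≢ c {zero}  {suc i} i≢d = refl
coeff-monomial-≢ c {suc d} {zero}  i≢d = refl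
coeff-monomial-≢ c {suc d} {suc i} i≢d = coeff-monomial-≢ c (i≢d ∘ cong suc)

coeff-applyUpTo-< : ∀ (f : ℕ → ℤ) {n i} → i < n → coeff (applyUpTo f n) i ≡ f i
coeff-applyUpTo-< f {suc n} {zero}  _          = refl
coeff-applyUpTo-< f {suc n} {suc i} (s≤s i<n) = coeff-applyUpTo-< (f ∘ suc) i<n

coeff-applyUpTo-≥ : ∀ (f : ℕ → ℤ) {n i} → n ≤ i → coeff (applyUpTo f n) i ≡ + 0
coeff-applyUpTo-≥ f {zero}          _         = refl
coeff-applyUpTo-≥ f {suc n} {suc i} (s≤s n≤i) = coeff-applyUpTo-≥ (f ∘ suc) n≤i

coeff-rev-≤ : ∀ r p {i} → i ≤ r → coeff (rev r p) i ≡ coeff p (r ∸ i)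
coeff-rev-≤ r p {i} i≤r = trans (cong (λ q → coeff q i) (map-applyUpTo id (λ j → coeff p (r ∸ j)) (suc r)))
                            (coeff-applyUpTo-< (λ j → coeff p (r ∸ j)) (s≤s i≤r))

coeff-rev-> : ∀ r p {i} → r < i → coeff (rev r p) i ≡ + 0
coeff-rev-> r p {i} r<i = trans (cong (λ q → coeff q i) (map-applyUpTo id (λ j → coeff p (r ∸ j)) (suc r)))
                            (coeff-applyUpTo-≥ (λ j → coeff p (r ∸ j)) r<i)

coeff-*ₚ : ∀ p q i → coeff (p *ₚ q) i ≡ Σ< (suc i) (λ j → coeff p j * coeff q (i ∸ j))
coeff-*ₚ []      q i       = sym (Σ<-zero (suc i) (λ j _ → ℤ.*-zeroˡ (coeff q (i ∸ j))))
coeff-*ₚ (a ∷ p) q zero    =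
  trans (coeff-+ₚ (scale a q) _ 0) (trans (cong (_+ + 0) (coeff-scale a q 0)) (ℤ.+-comm (a * coeff q 0) (+ 0)))
coeff-*ₚ (a ∷ p) q (suc i) = begin
  coeff (scale a q +ₚ (+ 0 ∷ (p *ₚ q))) (suc i)                     ≡⟨ coeff-+ₚ (scale a q) _ (suc i) ⟩
  coeff (scale a q) (suc i) + coeff (p *ₚ q) i                      ≡⟨ cong₂ _+_ (coeff-scale a q (suc i)) (coeff-*ₚ p q i) ⟩
  a * coeff q (suc i) + Σ< (suc i) (λ j → coeff p j * coeff q (i ∸ j))
                                                                    ≡⟨ Σ<-suc (suc i) (λ j → coeff (a ∷ p) j * coeff q (suc i ∸ j)) ⟨
  Σ< (suc (suc i)) (λ j → coeff (a ∷ p) j * coeff q (suc i ∸ j))    ∎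
  where open ≡-Reasoning

coeff-*ₚ-≈oneₚ : ∀ p q i → p ≈ₚ oneₚ → coeff (p *ₚ q) i ≡ coeff q i
coeff-*ₚ-≈oneₚ p q i p≈1 = begin
  coeff (p *ₚ q) i                                            ≡⟨ coeff-*ₚ p q i ⟩
  Σ< (suc i) (λ j → coeff p j * coeff q (i ∸ j))              ≡⟨ Σ<-cong (suc i) (λ j _ → cong (_* coeff q (i ∸ j)) (p≈1 j)) ⟩
  Σ< (suc i) (λ j → coeff oneₚ j * coeff q (i ∸ j))           ≡⟨ Σ<-suc i _ ⟩
  + 1 * coeff q i + Σ< i (λ j → + 0 * coeff q (i ∸ suc j))   ≡⟨ cong₂ _+_ (ℤ.*-identityˡ (coeff q i)) (Σ<-zero i (λ _ _ → refl)) ⟩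
  coeff q i + + 0                                             ≡⟨ ℤ.+-identityʳ (coeff q i) ⟩
  coeff q i                                                   ∎
  where open ≡-Reasoning

coeff-*ₚ-constant : ∀ p c i → coeff (p *ₚ (c ∷ [])) i ≡ c * coeff p i
coeff-*ₚ-constant p c i = begin
  coeff (p *ₚ (c ∷ [])) i
    ≡⟨ coeff-*ₚ p (c ∷ []) i ⟩
  Σ< i (λ j → coeff p j * coeff (c ∷ []) (i ∸ j)) + coeff p i * coeff (c ∷ []) (i ∸ i)
    ≡⟨ cong₂ _+_ (Σ<-zero i lower-terms) (cong (λ k → coeff p i * coeff (c ∷ []) k) (ℕ.n∸n≡0 i)) ⟩
  + 0 + coeff p i * c
    ≡⟨ trans (ℤ.+-identityˡ _) (ℤ.*-comm (coeff p i) c) ⟩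
  c * coeff p i
    ∎
  where
  open ≡-Reasoning
  lower-terms : ∀ j → j < i → coeff p j * coeff (c ∷ []) (i ∸ j) ≡ + 0
  lower-terms j j<i with i ∸ j | ℕ.m<n⇒0<n∸m j<i
  ... | suc _ | _ = ℤ.*-zeroʳ (coeff p j)

Σ-coeff-monomial-hit : ∀ N (f : ℕ → ℤ) (e : ℕ → ℕ) {i} x → x < N → e x ≡ i → (∀ y → y < N → e y ≡ i → y ≡ x) →
                       Σ< N (λ y → coeff (monomial (f y) (e y)) i) ≡ f x
Σ-coeff-monomial-hit N f e x x<N ex≡i unique =
  trans (Σ<-single N x _ x<N (λ y y<N y≢x → coeff-monomial-≢ (f y) (λ i≡ey → y≢x (unique y y<N (sym i≡ey)))))
        (trans (cong (coeff (monomial (f x) (e x))) (sym ex≡i)) (coeff-monomial-≡ (f x) (e x)))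

Σ-coeff-monomial-miss : ∀ N (f : ℕ → ℤ) (e : ℕ → ℕ) {i} → (∀ y → y < N → e y ≢ i) →
                        Σ< N (λ y → coeff (monomial (f y) (e y)) i) ≡ + 0
Σ-coeff-monomial-miss N f e miss = Σ<-zero N (λ y y<N → coeff-monomial-≢ (f y) (miss y y<N ∘ sym))

T⇒≡true : ∀ {b} → T b → b ≡ true
T⇒≡true = Equivalence.to T-≡

¬T⇒≡false : ∀ {b} → ¬ T b → b ≡ false
¬T⇒≡false {false} _  = refl
¬T⇒≡false {true}  ¬t = contradiction _ ¬t

if-true : ∀ {A : Set} {b} {x y : A} → b ≡ true → (if b then x else y) ≡ x
if-true refl = refl

if-false : ∀ {A : Set} {b} {x y : A} → b ≡ false → (if b then x else y) ≡ y
if-false refl = refl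

if-const : ∀ b (x : ℤ) → (if b then x else x) ≡ x
if-const false x = refl
if-const true  x = refl

<ᵇ-true : ∀ {m n} → m < n → (m <ᵇ n) ≡ true
<ᵇ-true = T⇒≡true ∘ ℕ.<⇒<ᵇ

<ᵇ-false : ∀ {m n} → ¬ m < n → (m <ᵇ n) ≡ false
<ᵇ-false {m} {n} m≮n = ¬T⇒≡false (m≮n ∘ ℕ.<ᵇ⇒< m n)

≡ᵇ-true : ∀ n → (n ≡ᵇ n) ≡ true
≡ᵇ-true n = T⇒≡true (ℕ.≡⇒≡ᵇ n n refl)

≡ᵇ-false : ∀ {m n} → m ≢ n → (m ≡ᵇ n) ≡ false
≡ᵇ-false {m} {n} m≢n = ¬T⇒≡false (m≢n ∘ ℕ.≡ᵇ⇒≡ m n)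

⌊⌋-true : ∀ {P : Set} (P? : Dec P) → P → ⌊ P? ⌋ ≡ true
⌊⌋-true P? p = T⇒≡true (fromWitness p)

⌊⌋-false : ∀ {P : Set} (P? : Dec P) → ¬ P → ⌊ P? ⌋ ≡ false
⌊⌋-false P? ¬p = ¬T⇒≡false (¬p ∘ toWitness)

module _ {n : ℕ} where

  ⊆ᵇ-true : {A B : Subset n} → A ⊆ B → A ⊆ᵇ B ≡ true
  ⊆ᵇ-true {A} {B} = ⌊⌋-true (A ⊆? B)

  ⊆ᵇ-outside : ∀ s (A B : Subset n) → (outside ∷ A) ⊆ᵇ (s ∷ B) ≡ A ⊆ᵇ B
  ⊆ᵇ-outside s A B = ⌊⌋-map′ _ _ (A ⊆? B)

  ⊆ᵇ-inside : ∀ (A B : Subset n) → (inside ∷ A) ⊆ᵇ (inside ∷ B) ≡ A ⊆ᵇ B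
  ⊆ᵇ-inside A B = ⌊⌋-map′ _ _ (A ⊆? B)

==ᵇ-true : ∀ {n} {p q : Subset n} → p ≡ q → p ==ᵇ q ≡ true
==ᵇ-true {p = p} {q} = ⌊⌋-true (≡-dec Bool._≟_ p q)

==ᵇ-false : ∀ {n} {p q : Subset n} → p ≢ q → p ==ᵇ q ≡ false
==ᵇ-false {p = p} {q} = ⌊⌋-false (≡-dec Bool._≟_ p q)

allᵇ-true : ∀ {X : Set} (P : X → Bool) xs → (∀ x → P x ≡ true) → allᵇ P xs ≡ true
allᵇ-true P []       _   = refl
allᵇ-true P (x ∷ xs) all rewrite all x = allᵇ-true P xs all

allᵇ-false : ∀ {X : Set} (P : X → Bool) {x} xs → x List.∈ xs → P x ≡ false → allᵇ P xs ≡ false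
allᵇ-false P (y ∷ xs) (here refl) Px≡false rewrite Px≡false = refl
allᵇ-false P (y ∷ xs) (there x∈xs) Px≡false rewrite allᵇ-false P xs x∈xs Px≡false = ∧-zeroʳ (P y)

lookup-∉ : ∀ {n} {p : Subset n} {x} → x ∉ p → lookup p x ≡ false
lookup-∉ {p = p} {x} x∉p with lookup p x in eq
... | false = refl
... | true  = contradiction (lookup⇒[]= x p eq) x∉p

p⊆q⇒∣p∣≡∣q∣⇒p≡q : ∀ {n} {p q : Subset n} → p ⊆ q → ∣ p ∣ ≡ ∣ q ∣ → p ≡ q
p⊆q⇒∣p∣≡∣q∣⇒p≡q {p = []}          {[]}          _   _  = refl
p⊆q⇒∣p∣≡∣q∣⇒p≡q {p = outside ∷ p} {outside ∷ q} p⊆q eq = cong (outside ∷_) (p⊆q⇒∣p∣≡∣q∣⇒p≡q (drop-∷-⊆ p⊆q) eq)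
p⊆q⇒∣p∣≡∣q∣⇒p≡q {p = outside ∷ p} {inside ∷ q}  p⊆q eq =
  contradiction (p⊆q⇒∣p∣≤∣q∣ (drop-∷-⊆ p⊆q)) (ℕ.<⇒≱ (ℕ.≤-reflexive (sym eq)))
p⊆q⇒∣p∣≡∣q∣⇒p≡q {p = inside ∷ p}  {outside ∷ q} p⊆q eq with p⊆q here
... | ()
p⊆q⇒∣p∣≡∣q∣⇒p≡q {p = inside ∷ p}  {inside ∷ q}  p⊆q eq = cong (inside ∷_) (p⊆q⇒∣p∣≡∣q∣⇒p≡q (drop-∷-⊆ p⊆q) (ℕ.suc-injective eq))

p⊆q⇒∣p∣<∣q∣⇒p⊂q : ∀ {n} {p q : Subset n} → p ⊆ q → ∣ p ∣ < ∣ q ∣ → p ⊂ q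
p⊆q⇒∣p∣<∣q∣⇒p⊂q p⊆q ∣p∣<∣q∣ = p⊆q , witness p⊆q ∣p∣<∣q∣
  where
  witness : ∀ {n} {p q : Subset n} → p ⊆ q → ∣ p ∣ < ∣ q ∣ → ∃ λ x → x ∈ q × x ∉ p
  witness {p = outside ∷ p} {outside ∷ q} p⊆q lt with witness (drop-∷-⊆ p⊆q) lt
  ... | x , x∈q , x∉p = suc x , there x∈q , x∉p ∘ drop-there
  witness {p = outside ∷ p} {inside ∷ q}  p⊆q lt = zero , here , λ ()
  witness {p = inside ∷ p}  {outside ∷ q} p⊆q lt with p⊆q here
  ... | ()
  witness {p = inside ∷ p}  {inside ∷ q}  p⊆q lt with witness (drop-∷-⊆ p⊆q) (ℕ.≤-pred lt)
  ... | x , x∈q , x∉p = suc x , there x∈q , x∉p ∘ drop-there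

⊂ᵇ≡⊆ᵇ∧<ᵇ : ∀ {n} (p q : Subset n) → p ⊂ᵇ q ≡ (p ⊆ᵇ q) ∧ (∣ p ∣ <ᵇ ∣ q ∣)
⊂ᵇ≡⊆ᵇ∧<ᵇ p q with p ⊆? q
... | no p⊈q = ⌊⌋-false (p ⊂? q) (p⊈q ∘ proj₁)
... | yes p⊆q with ∣ p ∣ ℕ.<? ∣ q ∣
...   | yes lt = trans (⌊⌋-true (p ⊂? q) (p⊆q⇒∣p∣<∣q∣⇒p⊂q p⊆q lt)) (sym (<ᵇ-true lt))
...   | no ¬lt = trans (⌊⌋-false (p ⊂? q) (¬lt ∘ p⊂q⇒∣p∣<∣q∣)) (sym (<ᵇ-false ¬lt))

∪-lub : ∀ {n} {p q r : Subset n} → p ⊆ r → q ⊆ r → p ∪ q ⊆ r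
∪-lub {p = p} {q} p⊆r q⊆r x∈p∪q with x∈p∪q⁻ p q x∈p∪q
... | inj₁ x∈p = p⊆r x∈p
... | inj₂ x∈q = q⊆r x∈q

∣p∪q∣+∣p∩q∣≡∣p∣+∣q∣ : ∀ {n} (p q : Subset n) → ∣ p ∪ q ∣ +ℕ ∣ p ∩ q ∣ ≡ ∣ p ∣ +ℕ ∣ q ∣
∣p∪q∣+∣p∩q∣≡∣p∣+∣q∣ []            []            = refl
∣p∪q∣+∣p∩q∣≡∣p∣+∣q∣ (outside ∷ p) (outside ∷ q) = ∣p∪q∣+∣p∩q∣≡∣p∣+∣q∣ p q
∣p∪q∣+∣p∩q∣≡∣p∣+∣q∣ (outside ∷ p) (inside ∷ q)  =
  trans (cong suc (∣p∪q∣+∣p∩q∣≡∣p∣+∣q∣ p q)) (sym (ℕ.+-suc ∣ p ∣ ∣ q ∣))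
∣p∪q∣+∣p∩q∣≡∣p∣+∣q∣ (inside ∷ p)  (outside ∷ q) = cong suc (∣p∪q∣+∣p∩q∣≡∣p∣+∣q∣ p q)
∣p∪q∣+∣p∩q∣≡∣p∣+∣q∣ (inside ∷ p)  (inside ∷ q)  = cong suc (begin
  ∣ p ∪ q ∣ +ℕ suc ∣ p ∩ q ∣   ≡⟨ ℕ.+-suc ∣ p ∪ q ∣ ∣ p ∩ q ∣ ⟩
  suc (∣ p ∪ q ∣ +ℕ ∣ p ∩ q ∣) ≡⟨ cong suc (∣p∪q∣+∣p∩q∣≡∣p∣+∣q∣ p q) ⟩
  suc (∣ p ∣ +ℕ ∣ q ∣)         ≡⟨ ℕ.+-suc ∣ p ∣ ∣ q ∣ ⟨
  ∣ p ∣ +ℕ suc ∣ q ∣           ∎)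
  where open ≡-Reasoning

∣p∪q∣≡∣p∣+∣q∣ : ∀ {n} (p q : Subset n) → (∀ {x} → x ∈ q → x ∉ p) → ∣ p ∪ q ∣ ≡ ∣ p ∣ +ℕ ∣ q ∣
∣p∪q∣≡∣p∣+∣q∣ []            []            _        = refl
∣p∪q∣≡∣p∣+∣q∣ (outside ∷ p) (outside ∷ q) disjoint = ∣p∪q∣≡∣p∣+∣q∣ p q (λ x∈q x∈p → disjoint (there x∈q) (there x∈p))
∣p∪q∣≡∣p∣+∣q∣ (inside ∷ p)  (outside ∷ q) disjoint =
  cong suc (∣p∪q∣≡∣p∣+∣q∣ p q (λ x∈q x∈p → disjoint (there x∈q) (there x∈p)))
∣p∪q∣≡∣p∣+∣q∣ (outside ∷ p) (inside ∷ q)  disjoint =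
  trans (cong suc (∣p∪q∣≡∣p∣+∣q∣ p q (λ x∈q x∈p → disjoint (there x∈q) (there x∈p)))) (sym (ℕ.+-suc ∣ p ∣ ∣ q ∣))
∣p∪q∣≡∣p∣+∣q∣ (inside ∷ p)  (inside ∷ q)  disjoint = contradiction here (disjoint here)

∣p─q∣+∣q∣≡∣p∣ : ∀ {n} (p q : Subset n) → q ⊆ p → ∣ p ─ q ∣ +ℕ ∣ q ∣ ≡ ∣ p ∣
∣p─q∣+∣q∣≡∣p∣ []            []            _   = refl
∣p─q∣+∣q∣≡∣p∣ (outside ∷ p) (outside ∷ q) q⊆p = ∣p─q∣+∣q∣≡∣p∣ p q (drop-∷-⊆ q⊆p)
∣p─q∣+∣q∣≡∣p∣ (inside ∷ p)  (outside ∷ q) q⊆p = cong suc (∣p─q∣+∣q∣≡∣p∣ p q (drop-∷-⊆ q⊆p))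
∣p─q∣+∣q∣≡∣p∣ (outside ∷ p) (inside ∷ q)  q⊆p with q⊆p here
... | ()
∣p─q∣+∣q∣≡∣p∣ (inside ∷ p)  (inside ∷ q)  q⊆p =
  trans (ℕ.+-suc ∣ p ─ q ∣ ∣ q ∣) (cong suc (∣p─q∣+∣q∣≡∣p∣ p q (drop-∷-⊆ q⊆p)))

∣p─q∣≡∣p∣∸∣q∣ : ∀ {n} (p q : Subset n) → q ⊆ p → ∣ p ─ q ∣ ≡ ∣ p ∣ ∸ ∣ q ∣
∣p─q∣≡∣p∣∸∣q∣ p q q⊆p = trans (sym (ℕ.m+n∸n≡m ∣ p ─ q ∣ ∣ q ∣)) (cong (_∸ ∣ q ∣) (∣p─q∣+∣q∣≡∣p∣ p q q⊆p))

x∈p─q⇒x∉q : ∀ {n} (p q : Subset n) {x} → x ∈ p ─ q → x ∉ q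
x∈p─q⇒x∉q (inside ∷ p)  (outside ∷ q) here        ()
x∈p─q⇒x∉q (s ∷ p)       (t ∷ q)       (there x∈) (there x∈q) = x∈p─q⇒x∉q p q x∈ x∈q

sumℤ-++ : ∀ xs ys → sumℤ (xs ++ ys) ≡ sumℤ xs + sumℤ ys
sumℤ-++ []       ys = sym (ℤ.+-identityˡ _)
sumℤ-++ (x ∷ xs) ys = trans (cong (λ z → x + z) (sumℤ-++ xs ys)) (sym (ℤ.+-assoc x _ _))

sumℤ-map-map : ∀ {X Y : Set} (f : Y → ℤ) (g : X → Y) xs → sumℤ (map f (map g xs)) ≡ sumℤ (map (f ∘ g) xs)
sumℤ-map-map f g []       = refl
sumℤ-map-map f g (x ∷ xs) = cong (λ z → f (g x) + z) (sumℤ-map-map f g xs)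

sumℤ-map-cong : ∀ {X : Set} {f g : X → ℤ} xs → (∀ x → f x ≡ g x) → sumℤ (map f xs) ≡ sumℤ (map g xs)
sumℤ-map-cong []       eq = refl
sumℤ-map-cong (x ∷ xs) eq = cong₂ _+_ (eq x) (sumℤ-map-cong xs eq)

sumℤ-map-filterᵇ : ∀ {X : Set} (P : X → Bool) (g : X → ℤ) xs →
                   sumℤ (map g (filterᵇ P xs)) ≡ sumℤ (map (λ x → if P x then g x else + 0) xs)
sumℤ-map-filterᵇ P g []       = refl
sumℤ-map-filterᵇ P g (x ∷ xs) with P x
... | true  = cong (λ z → g x + z) (sumℤ-map-filterᵇ P g xs)
... | false = trans (sumℤ-map-filterᵇ P g xs) (sym (ℤ.+-identityˡ _))

Σ-subsets : (N : ℕ) → (Subset N → ℤ) → ℤ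
Σ-subsets N F = sumℤ (map F (allSubsets N))

Σ-subsets-suc : ∀ N (F : Subset (suc N) → ℤ) →
                Σ-subsets (suc N) F ≡ Σ-subsets N (F ∘ (inside ∷_)) + Σ-subsets N (F ∘ (outside ∷_))
Σ-subsets-suc N F = begin
  sumℤ (map F (map (inside ∷_) (allSubsets N) ++ map (outside ∷_) (allSubsets N)))
    ≡⟨ cong sumℤ (map-++ F (map (inside ∷_) (allSubsets N)) _) ⟩
  sumℤ (map F (map (inside ∷_) (allSubsets N)) ++ map F (map (outside ∷_) (allSubsets N)))
    ≡⟨ sumℤ-++ (map F (map (inside ∷_) (allSubsets N))) _ ⟩
  sumℤ (map F (map (inside ∷_) (allSubsets N))) + sumℤ (map F (map (outside ∷_) (allSubsets N)))
    ≡⟨ cong₂ _+_ (sumℤ-map-map F (inside ∷_) (allSubsets N)) (sumℤ-map-map F (outside ∷_) (allSubsets N)) ⟩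
  Σ-subsets N (F ∘ (inside ∷_)) + Σ-subsets N (F ∘ (outside ∷_))
    ∎
  where open ≡-Reasoning

Σ-subsets-cong : ∀ N {F G : Subset N → ℤ} → (∀ A → F A ≡ G A) → Σ-subsets N F ≡ Σ-subsets N G
Σ-subsets-cong N = sumℤ-map-cong (allSubsets N)

Σ-subsets-zero : ∀ N → Σ-subsets N (λ _ → + 0) ≡ + 0
Σ-subsets-zero zero    = refl
Σ-subsets-zero (suc N) = trans (Σ-subsets-suc N (λ _ → + 0)) (cong₂ _+_ (Σ-subsets-zero N) (Σ-subsets-zero N))

Σ-⊆-by-size : ∀ {N} (G : Subset N) (h : ℕ → ℤ) →
              Σ-subsets N (λ A → if A ⊆ᵇ G then h ∣ A ∣ else + 0) ≡ Σ< (suc ∣ G ∣) (λ j → + (∣ G ∣ C j) * h j)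
Σ-⊆-by-size [] h = trans (ℤ.+-identityʳ (h 0)) (sym (trans (ℤ.+-identityˡ _) (ℤ.*-identityˡ (h 0))))
Σ-⊆-by-size {suc N} (outside ∷ G) h = begin
  Σ-subsets (suc N) (λ A → if A ⊆ᵇ (outside ∷ G) then h ∣ A ∣ else + 0)
    ≡⟨ Σ-subsets-suc N _ ⟩
  Σ-subsets N (λ _ → + 0) + Σ-subsets N (λ A → if (outside ∷ A) ⊆ᵇ (outside ∷ G) then h ∣ A ∣ else + 0)
    ≡⟨ cong₂ _+_ (Σ-subsets-zero N) (Σ-subsets-cong N (λ A → cong (λ b → if b then h ∣ A ∣ else + 0) (⊆ᵇ-outside outside A G))) ⟩
  + 0 + Σ-subsets N (λ A → if A ⊆ᵇ G then h ∣ A ∣ else + 0)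
    ≡⟨ trans (ℤ.+-identityˡ _) (Σ-⊆-by-size G h) ⟩
  Σ< (suc ∣ G ∣) (λ j → + (∣ G ∣ C j) * h j)
    ∎
  where open ≡-Reasoning
Σ-⊆-by-size {suc N} (inside ∷ G) h = begin
  Σ-subsets (suc N) (λ A → if A ⊆ᵇ (inside ∷ G) then h ∣ A ∣ else + 0)
    ≡⟨ Σ-subsets-suc N _ ⟩
  Σ-subsets N (λ A → if (inside ∷ A) ⊆ᵇ (inside ∷ G) then h (suc ∣ A ∣) else + 0)
    + Σ-subsets N (λ A → if (outside ∷ A) ⊆ᵇ (inside ∷ G) then h ∣ A ∣ else + 0)
    ≡⟨ cong₂ _+_ (Σ-subsets-cong N (λ A → cong (λ b → if b then h (suc ∣ A ∣) else + 0) (⊆ᵇ-inside A G)))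
                 (Σ-subsets-cong N (λ A → cong (λ b → if b then h ∣ A ∣ else + 0) (⊆ᵇ-outside inside A G))) ⟩
  Σ-subsets N (λ A → if A ⊆ᵇ G then h (suc ∣ A ∣) else + 0) + Σ-subsets N (λ A → if A ⊆ᵇ G then h ∣ A ∣ else + 0)
    ≡⟨ cong₂ _+_ (Σ-⊆-by-size G (h ∘ suc)) (Σ-⊆-by-size G h) ⟩
  Σ< (suc ∣ G ∣) (λ j → + (∣ G ∣ C j) * h (suc j)) + Σ< (suc ∣ G ∣) (λ j → + (∣ G ∣ C j) * h j)
    ≡⟨ Σ-pascal ∣ G ∣ h ⟩
  Σ< (suc (suc ∣ G ∣)) (λ j → + (suc ∣ G ∣ C j) * h j)
    ∎
  where open ≡-Reasoning

Σ-⊆-by-size-split : ∀ {N} (G : Subset N) c (h : ℕ → ℤ) (top : ℤ) → c ≤ ∣ G ∣ →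
  Σ-subsets N (λ A → if A ⊆ᵇ G then (if ∣ A ∣ <ᵇ c then h ∣ A ∣ else if ∣ A ∣ ≡ᵇ ∣ G ∣ then top else + 0) else + 0)
  ≡ Σ< c (λ j → + (∣ G ∣ C j) * h j) + top
Σ-⊆-by-size-split {N} G c h top c≤g = begin
  Σ-subsets N (λ A → if A ⊆ᵇ G then h′ ∣ A ∣ else + 0)          ≡⟨ Σ-⊆-by-size G h′ ⟩
  Σ< g (λ j → + (g C j) * h′ j) + + (g C g) * h′ g              ≡⟨ cong₂ _+_ (Σ<-truncate c g c≤g middle) top-term ⟩
  Σ< c (λ j → + (g C j) * h′ j) + top                           ≡⟨ cong (_+ top) (Σ<-cong c (λ j j<c → cong (+ (g C j) *_) (below j j<c))) ⟩
  Σ< c (λ j → + (g C j) * h j) + top                            ∎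
  where
  open ≡-Reasoning
  g : ℕ
  g = ∣ G ∣
  h′ : ℕ → ℤ
  h′ j = if j <ᵇ c then h j else if j ≡ᵇ g then top else + 0
  below : ∀ j → j < c → h′ j ≡ h j
  below j j<c rewrite <ᵇ-true j<c = refl
  middle : ∀ j → c ≤ j → j < g → + (g C j) * h′ j ≡ + 0
  middle j c≤j j<g rewrite <ᵇ-false (ℕ.≤⇒≯ c≤j) | ≡ᵇ-false (ℕ.<⇒≢ j<g) = ℤ.*-zeroʳ (+ (g C j))
  top-term : + (g C g) * h′ g ≡ top
  top-term rewrite nCn≡1 g | <ᵇ-false (ℕ.≤⇒≯ c≤g) | ≡ᵇ-true g = ℤ.*-identityˡ top

-- Uniform matroids

[m+n]⊓o∸n⊓o≡m⊓[o∸n] : ∀ m n o → (m +ℕ n) ⊓ o ∸ n ⊓ o ≡ m ⊓ (o ∸ n)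
[m+n]⊓o∸n⊓o≡m⊓[o∸n] m zero    o       = cong (_⊓ o) (ℕ.+-identityʳ m)
[m+n]⊓o∸n⊓o≡m⊓[o∸n] m (suc n) zero    = trans (ℕ.⊓-zeroʳ (m +ℕ suc n)) (sym (ℕ.⊓-zeroʳ m))
[m+n]⊓o∸n⊓o≡m⊓[o∸n] m (suc n) (suc o) =
  trans (cong (λ a → a ⊓ suc o ∸ suc (n ⊓ o)) (ℕ.+-suc m n)) ([m+n]⊓o∸n⊓o≡m⊓[o∸n] m n o)

⊓-submodular : ∀ r {u i a b} → u +ℕ i ≡ a +ℕ b → i ≤ a → i ≤ b → u ⊓ r +ℕ i ⊓ r ≤ a ⊓ r +ℕ b ⊓ r
⊓-submodular r {u} {i} {a} {b} u+i≡a+b i≤a i≤b with ℕ.≤-total r a | ℕ.≤-total r b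
... | inj₁ r≤a | inj₁ r≤b rewrite ℕ.m≥n⇒m⊓n≡n r≤a | ℕ.m≥n⇒m⊓n≡n r≤b =
  ℕ.+-mono-≤ (ℕ.m⊓n≤n u r) (ℕ.m⊓n≤n i r)
... | inj₂ a≤r | inj₂ b≤r rewrite ℕ.m≤n⇒m⊓n≡m a≤r | ℕ.m≤n⇒m⊓n≡m b≤r | ℕ.m≤n⇒m⊓n≡m (ℕ.≤-trans i≤a a≤r) =
  subst (u ⊓ r +ℕ i ≤_) u+i≡a+b (ℕ.+-monoˡ-≤ i (ℕ.m⊓n≤m u r))
... | inj₂ a≤r | inj₁ r≤b rewrite ℕ.m≤n⇒m⊓n≡m a≤r | ℕ.m≥n⇒m⊓n≡n r≤b | ℕ.m≤n⇒m⊓n≡m (ℕ.≤-trans i≤a a≤r) =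
  subst (u ⊓ r +ℕ i ≤_) (ℕ.+-comm r a) (ℕ.+-mono-≤ (ℕ.m⊓n≤n u r) i≤a)
... | inj₁ r≤a | inj₂ b≤r rewrite ℕ.m≥n⇒m⊓n≡n r≤a | ℕ.m≤n⇒m⊓n≡m b≤r | ℕ.m≤n⇒m⊓n≡m (ℕ.≤-trans i≤b b≤r) =
  ℕ.+-mono-≤ (ℕ.m⊓n≤n u r) i≤b

⊓-<ᵇ-suc : ∀ m r → (m ⊓ r <ᵇ suc m ⊓ r) ≡ (m <ᵇ r)
⊓-<ᵇ-suc zero    zero    = refl
⊓-<ᵇ-suc zero    (suc r) = refl
⊓-<ᵇ-suc (suc m) zero    = refl
⊓-<ᵇ-suc (suc m) (suc r) = ⊓-<ᵇ-suc m r

-- Up to relabelling M is U_{r,∣E∣}; the last field rules out loops when r = 0.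
record IsUniform {N} (M : RawMatroid N) (r : ℕ) : Set where
  field
    rk≡∣∣⊓r   : ∀ A → A ⊆ E M → rk M A ≡ ∣ A ∣ ⊓ r
    r≤∣E∣     : r ≤ ∣ E M ∣
    r≡0⇒∣E∣≡0 : r ≡ 0 → ∣ E M ∣ ≡ 0

module _ {N} {M : RawMatroid N} {r} (M-uniform : IsUniform M r) where

  open IsUniform M-uniform

  rank-uniform : rank M ≡ r
  rank-uniform = trans (rk≡∣∣⊓r (E M) ⊆-refl) (ℕ.m≥n⇒m⊓n≡n r≤∣E∣)

  restrict-uniform : ∀ G → G ⊆ E M → ∣ G ∣ ≤ r → IsUniform (restrict M G) ∣ G ∣
  restrict-uniform G G⊆E ∣G∣≤r = record
    { rk≡∣∣⊓r   = λ A A⊆G → let ∣A∣≤∣G∣ = p⊆q⇒∣p∣≤∣q∣ A⊆G in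
                  trans (rk≡∣∣⊓r A (⊆-trans A⊆G G⊆E))
                        (trans (ℕ.m≤n⇒m⊓n≡m (ℕ.≤-trans ∣A∣≤∣G∣ ∣G∣≤r)) (sym (ℕ.m≤n⇒m⊓n≡m ∣A∣≤∣G∣)))
    ; r≤∣E∣     = ℕ.≤-refl
    ; r≡0⇒∣E∣≡0 = id
    }

  contract-uniform : ∀ F → F ⊆ E M → ∣ F ∣ < r ⊎ F ≡ E M → IsUniform (contract M F) (r ∸ ∣ F ∣)
  contract-uniform F F⊆E F-flat = record
    { rk≡∣∣⊓r   = rk-contract
    ; r≤∣E∣     = subst (r ∸ ∣ F ∣ ≤_) (sym (∣p─q∣≡∣p∣∸∣q∣ (E M) F F⊆E)) (ℕ.∸-monoˡ-≤ ∣ F ∣ r≤∣E∣)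
    ; r≡0⇒∣E∣≡0 = loopless F-flat
    }
    where
    rk-contract : ∀ A → A ⊆ E M ─ F → rk M (A ∪ F) ∸ rk M F ≡ ∣ A ∣ ⊓ (r ∸ ∣ F ∣)
    rk-contract A A⊆E─F = begin
      rk M (A ∪ F) ∸ rk M F                      ≡⟨ cong₂ _∸_ (rk≡∣∣⊓r (A ∪ F) (∪-lub (⊆-trans A⊆E─F (p─q⊆p (E M) F)) F⊆E))
                                                                (rk≡∣∣⊓r F F⊆E) ⟩
      ∣ A ∪ F ∣ ⊓ r ∸ ∣ F ∣ ⊓ r                  ≡⟨ cong (λ a → a ⊓ r ∸ ∣ F ∣ ⊓ r)
                                                         (∣p∪q∣≡∣p∣+∣q∣ A F (λ x∈F x∈A → x∈p─q⇒x∉q (E M) F (A⊆E─F x∈A) x∈F)) ⟩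
      (∣ A ∣ +ℕ ∣ F ∣) ⊓ r ∸ ∣ F ∣ ⊓ r           ≡⟨ [m+n]⊓o∸n⊓o≡m⊓[o∸n] ∣ A ∣ ∣ F ∣ r ⟩
      ∣ A ∣ ⊓ (r ∸ ∣ F ∣)                         ∎
      where open ≡-Reasoning
    loopless : ∣ F ∣ < r ⊎ F ≡ E M → r ∸ ∣ F ∣ ≡ 0 → ∣ E M ─ F ∣ ≡ 0
    loopless (inj₁ ∣F∣<r) r∸∣F∣≡0 = contradiction (sym r∸∣F∣≡0) (ℕ.<⇒≢ (ℕ.m<n⇒0<n∸m ∣F∣<r))
    loopless (inj₂ refl)  _       = trans (∣p─q∣≡∣p∣∸∣q∣ (E M) F F⊆E) (ℕ.n∸n≡0 ∣ F ∣)

  ⁅x⁆⊆E : ∀ {x} → x ∈ E M → ⁅ x ⁆ ⊆ E M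
  ⁅x⁆⊆E {x} x∈E y∈⁅x⁆ = subst (_∈ E M) (sym (x∈⁅y⁆⇒x≡y x y∈⁅x⁆)) x∈E

  uniform-isMatroid : IsMatroid M
  uniform-isMatroid = record
    { R1 = λ A A⊆E → subst (_≤ ∣ A ∣) (sym (rk≡∣∣⊓r A A⊆E)) (ℕ.m⊓n≤m ∣ A ∣ r)
    ; R2 = λ A B A⊆B B⊆E → subst₂ _≤_ (sym (rk≡∣∣⊓r A (⊆-trans A⊆B B⊆E))) (sym (rk≡∣∣⊓r B B⊆E))
                                        (ℕ.⊓-monoˡ-≤ r (p⊆q⇒∣p∣≤∣q∣ A⊆B))
    ; R3 = λ A B A⊆E B⊆E →
        subst₂ _≤_ (sym (cong₂ _+ℕ_ (rk≡∣∣⊓r (A ∪ B) (∪-lub A⊆E B⊆E)) (rk≡∣∣⊓r (A ∩ B) (⊆-trans (p∩q⊆p A B) A⊆E))))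
                   (sym (cong₂ _+ℕ_ (rk≡∣∣⊓r A A⊆E) (rk≡∣∣⊓r B B⊆E)))
                   (⊓-submodular r (∣p∪q∣+∣p∩q∣≡∣p∣+∣q∣ A B)
                                   (p⊆q⇒∣p∣≤∣q∣ (p∩q⊆p A B)) (p⊆q⇒∣p∣≤∣q∣ (p∩q⊆q A B)))
    }

  uniform-loopless : Loopless M
  uniform-loopless e e∈E = begin
    rk M ⁅ e ⁆     ≡⟨ rk≡∣∣⊓r ⁅ e ⁆ (⁅x⁆⊆E e∈E) ⟩
    ∣ ⁅ e ⁆ ∣ ⊓ r  ≡⟨ cong (_⊓ r) (∣⁅x⁆∣≡1 e) ⟩
    1 ⊓ r          ≡⟨ ℕ.m≤n⇒m⊓n≡m 1≤r ⟩
    1              ∎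
    where
    open ≡-Reasoning
    1≤∣E∣ : 1 ≤ ∣ E M ∣
    1≤∣E∣ = subst (_≤ ∣ E M ∣) (∣⁅x⁆∣≡1 e) (p⊆q⇒∣p∣≤∣q∣ (⁅x⁆⊆E e∈E))
    1≤r : 1 ≤ r
    1≤r = ℕ.n≢0⇒n>0 (λ r≡0 → contradiction (r≡0⇒∣E∣≡0 r≡0) (ℕ.<⇒≢ 1≤∣E∣ ∘ sym))

  -- The test applied to each element in isFlat, so that isFlat M A unfolds to
  -- (A ⊆ᵇ E M) ∧ allᵇ (extends A) (allFin N).
  extends : Subset N → Fin N → Bool
  extends A e = if lookup (E M) e ∧ not (lookup A e) then rk M A <ᵇ rk M (A ∪ ⁅ e ⁆) else true

  extends-uniform : ∀ A → A ⊆ E M → ∀ e →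
                    extends A e ≡ (if lookup (E M) e ∧ not (lookup A e) then ∣ A ∣ <ᵇ r else true)
  extends-uniform A A⊆E e with lookup (E M) e in E[e]≡true | lookup A e in A[e]≡false
  ... | false | _     = refl
  ... | true  | true  = refl
  ... | true  | false = begin
    rk M A <ᵇ rk M (A ∪ ⁅ e ⁆)          ≡⟨ cong₂ _<ᵇ_ (rk≡∣∣⊓r A A⊆E) (rk≡∣∣⊓r (A ∪ ⁅ e ⁆) (∪-lub A⊆E (⁅x⁆⊆E (lookup⇒[]= e _ E[e]≡true)))) ⟩
    ∣ A ∣ ⊓ r <ᵇ ∣ A ∪ ⁅ e ⁆ ∣ ⊓ r       ≡⟨ cong (λ a → ∣ A ∣ ⊓ r <ᵇ a ⊓ r) ∣A∪⁅e⁆∣≡1+∣A∣ ⟩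
    ∣ A ∣ ⊓ r <ᵇ suc ∣ A ∣ ⊓ r           ≡⟨ ⊓-<ᵇ-suc ∣ A ∣ r ⟩
    ∣ A ∣ <ᵇ r                            ∎
    where
    open ≡-Reasoning
    e∉A : e ∉ A
    e∉A e∈A = contradiction (trans (sym ([]=⇒lookup e∈A)) A[e]≡false) λ ()
    ∣A∪⁅e⁆∣≡1+∣A∣ : ∣ A ∪ ⁅ e ⁆ ∣ ≡ suc ∣ A ∣
    ∣A∪⁅e⁆∣≡1+∣A∣ = trans (∣p∪q∣≡∣p∣+∣q∣ A ⁅ e ⁆ (λ x∈⁅e⁆ → subst (_∉ A) (sym (x∈⁅y⁆⇒x≡y e x∈⁅e⁆)) e∉A))
                          (trans (cong (∣ A ∣ +ℕ_) (∣⁅x⁆∣≡1 e)) (ℕ.+-comm ∣ A ∣ 1))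

  allᵇ-extends : ∀ A → A ⊆ E M → allᵇ (extends A) (allFin N) ≡ (∣ A ∣ <ᵇ r) ∨ (∣ A ∣ ≡ᵇ ∣ E M ∣)
  allᵇ-extends A A⊆E with ∣ A ∣ ℕ.<? r
  ... | yes ∣A∣<r rewrite <ᵇ-true ∣A∣<r = allᵇ-true (extends A) (allFin N) (λ e → trans (extends-uniform A A⊆E e) (accepted e))
    where
    accepted : ∀ e → (if lookup (E M) e ∧ not (lookup A e) then ∣ A ∣ <ᵇ r else true) ≡ true
    accepted e rewrite <ᵇ-true ∣A∣<r with lookup (E M) e ∧ not (lookup A e)
    ... | false = refl
    ... | true  = refl
  ... | no ∣A∣≮r rewrite <ᵇ-false ∣A∣≮r with ∣ A ∣ ℕ.≟ ∣ E M ∣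
  ...   | yes ∣A∣≡∣E∣ rewrite p⊆q⇒∣p∣≡∣q∣⇒p≡q A⊆E ∣A∣≡∣E∣ | ≡ᵇ-true ∣ E M ∣ =
    allᵇ-true (extends (E M)) (allFin N) nothing-to-add
    where
    nothing-to-add : ∀ e → extends (E M) e ≡ true
    nothing-to-add e with lookup (E M) e
    ... | false = refl
    ... | true  = refl
  ...   | no ∣A∣≢∣E∣ with p⊆q⇒∣p∣<∣q∣⇒p⊂q A⊆E (ℕ.≤∧≢⇒< (p⊆q⇒∣p∣≤∣q∣ A⊆E) ∣A∣≢∣E∣)
  ...     | _ , e , e∈E , e∉A rewrite ≡ᵇ-false ∣A∣≢∣E∣ =
    allᵇ-false (extends A) (allFin N) (∈-allFin e) (trans (extends-uniform A A⊆E e) rejected)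
    where
    rejected : (if lookup (E M) e ∧ not (lookup A e) then ∣ A ∣ <ᵇ r else true) ≡ false
    rejected rewrite []=⇒lookup e∈E | lookup-∉ e∉A | <ᵇ-false ∣A∣≮r = refl

  isFlat-uniform : ∀ A → isFlat M A ≡ (A ⊆ᵇ E M) ∧ ((∣ A ∣ <ᵇ r) ∨ (∣ A ∣ ≡ᵇ ∣ E M ∣))
  isFlat-uniform A with A ⊆? E M
  ... | yes A⊆E = allᵇ-extends A A⊆E
  ... | no  _   = refl

  Σ-flats : ∀ g → sumℤ (map g (flats M)) ≡
            Σ-subsets N (λ A → if (A ⊆ᵇ E M) ∧ ((∣ A ∣ <ᵇ r) ∨ (∣ A ∣ ≡ᵇ ∣ E M ∣)) then g A else + 0)
  Σ-flats g = trans (sumℤ-map-filterᵇ (isFlat M) g (allSubsets N))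
                    (Σ-subsets-cong N (λ A → cong (λ b → if b then g A else + 0) (isFlat-uniform A)))

  Σ-flats-by-size : ∀ g (h : ℕ → ℤ) → (∀ A → A ⊆ E M → ∣ A ∣ < r → g A ≡ h ∣ A ∣) →
                    sumℤ (map g (flats M)) ≡ Σ< r (λ j → + (∣ E M ∣ C j) * h j) + g (E M)
  Σ-flats-by-size g h g≡h = trans (Σ-flats g) (trans (Σ-subsets-cong N by-size)
                                                      (Σ-⊆-by-size-split (E M) r h (g (E M)) r≤∣E∣))
    where
    by-size : ∀ A → (if (A ⊆ᵇ E M) ∧ ((∣ A ∣ <ᵇ r) ∨ (∣ A ∣ ≡ᵇ ∣ E M ∣)) then g A else + 0)
                  ≡ (if A ⊆ᵇ E M then (if ∣ A ∣ <ᵇ r then h ∣ A ∣ else if ∣ A ∣ ≡ᵇ ∣ E M ∣ then g (E M) else + 0) else + 0)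
    by-size A with A ⊆? E M
    ... | no _ = refl
    ... | yes A⊆E with ∣ A ∣ ℕ.<? r
    ...   | yes ∣A∣<r rewrite <ᵇ-true ∣A∣<r = g≡h A A⊆E ∣A∣<r
    ...   | no ∣A∣≮r rewrite <ᵇ-false ∣A∣≮r with ∣ A ∣ ℕ.≟ ∣ E M ∣
    ...     | yes ∣A∣≡∣E∣ rewrite p⊆q⇒∣p∣≡∣q∣⇒p≡q A⊆E ∣A∣≡∣E∣ | ≡ᵇ-true ∣ E M ∣ = refl
    ...     | no ∣A∣≢∣E∣ rewrite ≡ᵇ-false ∣A∣≢∣E∣ = refl

∈-allSubsets : ∀ {n} (A : Subset n) → A List.∈ allSubsets n
∈-allSubsets []                    = here refl
∈-allSubsets {suc n} (inside ∷ A)  = ∈-++⁺ˡ (∈-map⁺ (inside ∷_) (∈-allSubsets A))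
∈-allSubsets {suc n} (outside ∷ A) = ∈-++⁺ʳ (map (inside ∷_) (allSubsets n)) (∈-map⁺ (outside ∷_) (∈-allSubsets A))

rankFromBases-lub : ∀ {n} (A : Subset n) Bs {c} → (∀ {B} → B List.∈ Bs → ∣ A ∩ B ∣ ≤ c) → rankFromBases Bs A ≤ c
rankFromBases-lub A []       _  = z≤n
rankFromBases-lub A (B ∷ Bs) ub = ℕ.⊔-lub (ub (here refl)) (rankFromBases-lub A Bs (ub ∘ there))

rankFromBases-upper : ∀ {n} (A : Subset n) {Bs B} → B List.∈ Bs → ∣ A ∩ B ∣ ≤ rankFromBases Bs A
rankFromBases-upper A (here refl) = ℕ.m≤m⊔n _ _
rankFromBases-upper A (there B∈Bs) = ℕ.≤-trans (rankFromBases-upper A B∈Bs) (ℕ.m≤n⊔m _ _)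

∣p∩⊥∣≡0 : ∀ {n} (p : Subset n) → ∣ p ∩ ⊥ ∣ ≡ 0
∣p∩⊥∣≡0 {n} p = ℕ.n≤0⇒n≡0 (subst (∣ p ∩ ⊥ ∣ ≤_) (∣⊥∣≡0 n) (p⊆q⇒∣p∣≤∣q∣ (p∩q⊆q p ⊥)))

optimal-basis : ∀ {n} (A : Subset n) k → k ≤ n → ∃ λ B → ∣ B ∣ ≡ k × ∣ A ∩ B ∣ ≡ ∣ A ∣ ⊓ k
optimal-basis {n} A zero _ = ⊥ , ∣⊥∣≡0 n , trans (∣p∩⊥∣≡0 A) (sym (ℕ.⊓-zeroʳ ∣ A ∣))
optimal-basis (inside ∷ A) (suc k) (s≤s k≤n) with optimal-basis A k k≤n
... | B , ∣B∣≡k , ∣A∩B∣≡∣A∣⊓k = inside ∷ B , cong suc ∣B∣≡k , cong suc ∣A∩B∣≡∣A∣⊓k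
optimal-basis {suc n} (outside ∷ A) (suc k) (s≤s k≤n) with suc k ℕ.≤? n
... | yes 1+k≤n with optimal-basis A (suc k) 1+k≤n
...   | B , ∣B∣≡1+k , ∣A∩B∣≡∣A∣⊓1+k = outside ∷ B , ∣B∣≡1+k , ∣A∩B∣≡∣A∣⊓1+k
optimal-basis {suc n} (outside ∷ A) (suc k) (s≤s k≤n) | no 1+k≰n with optimal-basis A k k≤n
...   | B , ∣B∣≡k , ∣A∩B∣≡∣A∣⊓k = inside ∷ B , cong suc ∣B∣≡k , (begin
  ∣ A ∩ B ∣         ≡⟨ ∣A∩B∣≡∣A∣⊓k ⟩
  ∣ A ∣ ⊓ k         ≡⟨ ℕ.m≤n⇒m⊓n≡m ∣A∣≤k ⟩
  ∣ A ∣             ≡⟨ ℕ.m≤n⇒m⊓n≡m (ℕ.m≤n⇒m≤1+n ∣A∣≤k) ⟨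
  ∣ A ∣ ⊓ suc k     ∎)
  where
  open ≡-Reasoning
  ∣A∣≤k : ∣ A ∣ ≤ k
  ∣A∣≤k = subst (∣ A ∣ ≤_) (ℕ.≤-antisym (ℕ.≤-pred (ℕ.≰⇒> 1+k≰n)) k≤n) (∣p∣≤n A)

U-isUniform : ∀ k n → 1 ≤ k → k ≤ n → IsUniform (U k n) k
U-isUniform k n 1≤k k≤n = record
  { rk≡∣∣⊓r   = λ A _ → ℕ.≤-antisym (rankFromBases-lub A (uniformBases k n) (∣A∩basis∣≤∣A∣⊓k A)) (optimum A)
  ; r≤∣E∣     = subst (k ≤_) (sym (∣⊤∣≡n n)) k≤n
  ; r≡0⇒∣E∣≡0 = λ k≡0 → contradiction (sym k≡0) (ℕ.<⇒≢ 1≤k)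
  }
  where
  ∣A∩basis∣≤∣A∣⊓k : ∀ A {B} → B List.∈ uniformBases k n → ∣ A ∩ B ∣ ≤ ∣ A ∣ ⊓ k
  ∣A∩basis∣≤∣A∣⊓k A {B} B∈bases =
    subst (λ b → ∣ A ∩ B ∣ ≤ ∣ A ∣ ⊓ b) (ℕ.≡ᵇ⇒≡ ∣ B ∣ k (proj₂ (∈-filter⁻ (λ B → T? (∣ B ∣ ≡ᵇ k)) {xs = allSubsets n} B∈bases)))
          (∣p∩q∣≤∣p∣⊓∣q∣ A B)
  optimum : ∀ A → ∣ A ∣ ⊓ k ≤ rankFromBases (uniformBases k n) A
  optimum A with optimal-basis A k k≤n
  ... | B , ∣B∣≡k , ∣A∩B∣≡∣A∣⊓k =
    subst (_≤ rankFromBases (uniformBases k n) A) ∣A∩B∣≡∣A∣⊓k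
          (rankFromBases-upper A (∈-filter⁺ (λ B → T? (∣ B ∣ ≡ᵇ k)) (∈-allSubsets B) (ℕ.≡⇒≡ᵇ ∣ B ∣ k ∣B∣≡k)))

-- Möbius invariants and characteristic polynomials of uniform matroids

-- μ of U_{r,m}; truncated subtraction gives μU 0 0 = 1, as needed for the empty matroid.
μU : ℕ → ℕ → ℤ
μU m r = sgn r * + ((m ∸ 1) C (r ∸ 1))

μU-diagonal : ∀ n → μU n n ≡ sgn n
μU-diagonal n = trans (cong (λ c → sgn n * + c) (nCn≡1 (n ∸ 1))) (ℤ.*-identityʳ (sgn n))

μU≡-Σ : ∀ n c → 0 < n → 0 < c → μU n c ≡ - Σ< c (λ j → + (n C j) * sgn j)
μU≡-Σ (suc n) (suc c) _ _ = begin
  - sgn c * + (n C c)                              ≡⟨ ℤ.neg-distribˡ-* (sgn c) (+ (n C c)) ⟨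
  - (sgn c * + (n C c))                            ≡⟨ cong -_ (Σ-alternating-C n c) ⟨
  - Σ< (suc c) (λ j → sgn j * + (suc n C j))       ≡⟨ cong -_ (Σ<-cong (suc c) (λ j _ → ℤ.*-comm (sgn j) (+ (suc n C j)))) ⟩
  - Σ< (suc c) (λ j → + (suc n C j) * sgn j)       ∎
  where open ≡-Reasoning

-- Coefficients of t^r χ(t⁻¹) for U_{r,m}.
revχU : ℕ → ℕ → ℕ → ℤ
revχU m r d = if d <ᵇ r then sgn d * + (m C d) else if d ≡ᵇ r then μU m r else + 0

module _ {N} {M : RawMatroid N} {r} (M-uniform : IsUniform M r) where

  open IsUniform M-uniform

  Σ-strict-subflats : ∀ G → G ⊆ E M → (φ : Subset N → ℤ) →
                      (∀ H → H ⊆ G → ∣ H ∣ < ∣ G ∣ → ∣ H ∣ < r → φ H ≡ sgn ∣ H ∣) →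
                      sumℤ (map φ (filterᵇ (λ H → (⊥ ⊆ᵇ H) ∧ (H ⊂ᵇ G)) (flats M)))
                      ≡ Σ< (∣ G ∣ ⊓ r) (λ j → + (∣ G ∣ C j) * sgn j)
  Σ-strict-subflats G G⊆E φ φ≡sgn = begin
    sumℤ (map φ (filterᵇ below-G (flats M)))
      ≡⟨ sumℤ-map-filterᵇ below-G φ (flats M) ⟩
    sumℤ (map (λ H → if below-G H then φ H else + 0) (flats M))
      ≡⟨ Σ-flats M-uniform _ ⟩
    Σ-subsets N (λ H → if (H ⊆ᵇ E M) ∧ ((∣ H ∣ <ᵇ r) ∨ (∣ H ∣ ≡ᵇ ∣ E M ∣)) then (if below-G H then φ H else + 0) else + 0)
      ≡⟨ Σ-subsets-cong N by-size ⟩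
    Σ-subsets N (λ H → if H ⊆ᵇ G then (if ∣ H ∣ <ᵇ c then sgn ∣ H ∣ else if ∣ H ∣ ≡ᵇ ∣ G ∣ then + 0 else + 0) else + 0)
      ≡⟨ Σ-⊆-by-size-split G c sgn (+ 0) (ℕ.m⊓n≤m ∣ G ∣ r) ⟩
    Σ< c (λ j → + (∣ G ∣ C j) * sgn j) + + 0
      ≡⟨ ℤ.+-identityʳ _ ⟩
    Σ< c (λ j → + (∣ G ∣ C j) * sgn j)
      ∎
    where
    open ≡-Reasoning
    c : ℕ
    c = ∣ G ∣ ⊓ r
    below-G : Subset N → Bool
    below-G H = (⊥ ⊆ᵇ H) ∧ (H ⊂ᵇ G)
    by-size : ∀ H → (if (H ⊆ᵇ E M) ∧ ((∣ H ∣ <ᵇ r) ∨ (∣ H ∣ ≡ᵇ ∣ E M ∣)) then (if below-G H then φ H else + 0) else + 0)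
                  ≡ (if H ⊆ᵇ G then (if ∣ H ∣ <ᵇ c then sgn ∣ H ∣ else if ∣ H ∣ ≡ᵇ ∣ G ∣ then + 0 else + 0) else + 0)
    by-size H rewrite ⊆ᵇ-true (⊥⊆ {p = H}) | ⊂ᵇ≡⊆ᵇ∧<ᵇ H G with H ⊆? G
    ... | no _ = if-const _ (+ 0)
    ... | yes H⊆G rewrite ⊆ᵇ-true (⊆-trans H⊆G G⊆E) with ∣ H ∣ ℕ.<? ∣ G ∣
    ...   | no ∣H∣≮∣G∣ rewrite <ᵇ-false ∣H∣≮∣G∣ | <ᵇ-false (∣H∣≮∣G∣ ∘ λ ∣H∣<c → ℕ.<-≤-trans ∣H∣<c (ℕ.m⊓n≤m ∣ G ∣ r)) =
      trans (if-const _ (+ 0)) (sym (if-const _ (+ 0)))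
    ...   | yes ∣H∣<∣G∣ rewrite <ᵇ-true ∣H∣<∣G∣ with ∣ H ∣ ℕ.<? r
    ...     | yes ∣H∣<r rewrite <ᵇ-true ∣H∣<r | <ᵇ-true (ℕ.⊓-pres-m< ∣H∣<∣G∣ ∣H∣<r) = φ≡sgn H H⊆G ∣H∣<∣G∣ ∣H∣<r
    ...     | no ∣H∣≮r rewrite <ᵇ-false ∣H∣≮r | <ᵇ-false (∣H∣≮r ∘ λ ∣H∣<c → ℕ.<-≤-trans ∣H∣<c (ℕ.m⊓n≤n ∣ G ∣ r))
                             | ≡ᵇ-false (ℕ.<⇒≢ (ℕ.<-≤-trans ∣H∣<∣G∣ (p⊆q⇒∣p∣≤∣q∣ G⊆E))) =
      sym (if-const _ (+ 0))

  möb-uniform : ∀ f G → G ⊆ E M → ∣ G ∣ < f → ∣ G ∣ < r ⊎ G ≡ E M → möb M f ⊥ G ≡ μU ∣ G ∣ (∣ G ∣ ⊓ r)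
  möb-uniform (suc f) G G⊆E ∣G∣<1+f G-flat with ∣ G ∣ ℕ.≟ 0
  ... | yes ∣G∣≡0 = trans (if-true (==ᵇ-true G≡⊥)) (cong (λ g → μU g (g ⊓ r)) (sym ∣G∣≡0))
    where
    G≡⊥ : G ≡ ⊥
    G≡⊥ = sym (p⊆q⇒∣p∣≡∣q∣⇒p≡q ⊥⊆ (trans (∣⊥∣≡0 N) (sym ∣G∣≡0)))
  ... | no ∣G∣≢0 = begin
    möb M (suc f) ⊥ G
      ≡⟨ if-false (==ᵇ-false G≢⊥) ⟩
    - sumℤ (map (möb M f ⊥) (filterᵇ (λ H → (⊥ ⊆ᵇ H) ∧ (H ⊂ᵇ G)) (flats M)))
      ≡⟨ cong -_ (Σ-strict-subflats G G⊆E (möb M f ⊥) strict-subflat) ⟩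
    - Σ< (∣ G ∣ ⊓ r) (λ j → + (∣ G ∣ C j) * sgn j)
      ≡⟨ μU≡-Σ ∣ G ∣ (∣ G ∣ ⊓ r) (ℕ.n≢0⇒n>0 ∣G∣≢0) (ℕ.⊓-pres-m< (ℕ.n≢0⇒n>0 ∣G∣≢0) 0<r) ⟨
    μU ∣ G ∣ (∣ G ∣ ⊓ r)
      ∎
    where
    open ≡-Reasoning
    G≢⊥ : G ≢ ⊥
    G≢⊥ refl = ∣G∣≢0 (∣⊥∣≡0 N)
    0<r : 0 < r
    0<r = positive G-flat
      where
      positive : ∣ G ∣ < r ⊎ G ≡ E M → 0 < r
      positive (inj₁ ∣G∣<r) = ℕ.≤-<-trans z≤n ∣G∣<r
      positive (inj₂ refl)  = ℕ.n≢0⇒n>0 (∣G∣≢0 ∘ r≡0⇒∣E∣≡0)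
    strict-subflat : ∀ H → H ⊆ G → ∣ H ∣ < ∣ G ∣ → ∣ H ∣ < r → möb M f ⊥ H ≡ sgn ∣ H ∣
    strict-subflat H H⊆G ∣H∣<∣G∣ ∣H∣<r = begin
      möb M f ⊥ H             ≡⟨ möb-uniform f H (⊆-trans H⊆G G⊆E) (ℕ.<-≤-trans ∣H∣<∣G∣ (ℕ.≤-pred ∣G∣<1+f)) (inj₁ ∣H∣<r) ⟩
      μU (∣ H ∣) (∣ H ∣ ⊓ r)  ≡⟨ cong (μU ∣ H ∣) (ℕ.m≤n⇒m⊓n≡m (ℕ.<⇒≤ ∣H∣<r)) ⟩
      μU (∣ H ∣) (∣ H ∣)      ≡⟨ μU-diagonal ∣ H ∣ ⟩
      sgn (∣ H ∣)             ∎

  μ-uniform : μ M ≡ μU ∣ E M ∣ r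
  μ-uniform = trans (möb-uniform (suc N) (E M) ⊆-refl (s≤s (∣p∣≤n (E M))) (inj₂ refl))
                    (cong (μU ∣ E M ∣) (ℕ.m≥n⇒m⊓n≡n r≤∣E∣))

module _ {N} {M : RawMatroid N} {r} (M-uniform : IsUniform M r) where

  open IsUniform M-uniform

  module _ {F} (F⊆E : F ⊆ E M) (∣F∣<r : ∣ F ∣ < r) where

    rk-flat : rk M F ≡ ∣ F ∣
    rk-flat = trans (rk≡∣∣⊓r F F⊆E) (ℕ.m≤n⇒m⊓n≡m (ℕ.<⇒≤ ∣F∣<r))

    rank-contract-flat : rank (contract M F) ≡ r ∸ ∣ F ∣
    rank-contract-flat = rank-uniform (contract-uniform M-uniform F F⊆E (inj₁ ∣F∣<r))

    μ-restrict-flat : μ (restrict M F) ≡ sgn ∣ F ∣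
    μ-restrict-flat = trans (μ-uniform (restrict-uniform M-uniform F F⊆E (ℕ.<⇒≤ ∣F∣<r))) (μU-diagonal ∣ F ∣)

    μ-contract-flat : μ (contract M F) ≡ μU (∣ E M ∣ ∸ ∣ F ∣) (r ∸ ∣ F ∣)
    μ-contract-flat = trans (μ-uniform (contract-uniform M-uniform F F⊆E (inj₁ ∣F∣<r)))
                            (cong (λ m → μU m (r ∸ ∣ F ∣)) (∣p─q∣≡∣p∣∸∣q∣ (E M) F F⊆E))

  r∸∣E∣≡0 : r ∸ ∣ E M ∣ ≡ 0
  r∸∣E∣≡0 = ℕ.m≤n⇒m∸n≡0 r≤∣E∣

  rank-contract-E : rank (contract M (E M)) ≡ 0
  rank-contract-E = trans (rank-uniform (contract-uniform M-uniform (E M) ⊆-refl (inj₂ refl))) r∸∣E∣≡0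

  μ-contract-E : μ (contract M (E M)) ≡ + 1
  μ-contract-E = trans (μ-uniform (contract-uniform M-uniform (E M) ⊆-refl (inj₂ refl)))
                       (cong (μU ∣ E M ─ E M ∣) r∸∣E∣≡0)

  coeff-χ : ∀ e → coeff (χ M) e ≡ Σ< r (λ j → + (∣ E M ∣ C j) * coeff (monomial (sgn j) (r ∸ j)) e) + coeff (monomial (μ M) 0) e
  coeff-χ e = trans (coeff-sumₚ (λ F → monomial (μ (restrict M F)) (rank (contract M F))) (flats M) e)
                    (trans (Σ-flats-by-size M-uniform _ (λ j → coeff (monomial (sgn j) (r ∸ j)) e) per-flat)
                           (cong (λ d → Σ< r (λ j → + (∣ E M ∣ C j) * coeff (monomial (sgn j) (r ∸ j)) e) + coeff (monomial (μ M) d) e)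
                                 rank-contract-E))
    where
    per-flat : ∀ F → F ⊆ E M → ∣ F ∣ < r →
               coeff (monomial (μ (restrict M F)) (rank (contract M F))) e ≡ coeff (monomial (sgn ∣ F ∣) (r ∸ ∣ F ∣)) e
    per-flat F F⊆E ∣F∣<r = cong₂ (λ c d → coeff (monomial c d) e) (μ-restrict-flat F⊆E ∣F∣<r) (rank-contract-flat F⊆E ∣F∣<r)

  coeff-revχ : ∀ d → coeff (rev r (χ M)) d ≡ revχU ∣ E M ∣ r d
  coeff-revχ d with ℕ.<-cmp d r
  ... | tri> _ _ r<d rewrite <ᵇ-false (ℕ.<-asym r<d) | ≡ᵇ-false (ℕ.>⇒≢ r<d) = coeff-rev-> r (χ M) r<d
  ... | tri< d<r _ _ rewrite <ᵇ-true d<r = begin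
    coeff (rev r (χ M)) d
      ≡⟨ trans (coeff-rev-≤ r (χ M) (ℕ.<⇒≤ d<r)) (coeff-χ (r ∸ d)) ⟩
    Σ< r (λ j → + (m C j) * coeff (monomial (sgn j) (r ∸ j)) (r ∸ d)) + coeff (monomial (μ M) 0) (r ∸ d)
      ≡⟨ cong₂ _+_ (Σ<-single r d _ d<r other-terms) (coeff-monomial-≢ (μ M) (ℕ.>⇒≢ (ℕ.m<n⇒0<n∸m d<r))) ⟩
    + (m C d) * coeff (monomial (sgn d) (r ∸ d)) (r ∸ d) + + 0
      ≡⟨ trans (ℤ.+-identityʳ _) (cong (+ (m C d) *_) (coeff-monomial-≡ (sgn d) (r ∸ d))) ⟩
    + (m C d) * sgn d
      ≡⟨ ℤ.*-comm (+ (m C d)) (sgn d) ⟩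
    sgn d * + (m C d)
      ∎
    where
    open ≡-Reasoning
    m : ℕ
    m = ∣ E M ∣
    other-terms : ∀ j → j < r → j ≢ d → + (m C j) * coeff (monomial (sgn j) (r ∸ j)) (r ∸ d) ≡ + 0
    other-terms j j<r j≢d = trans (cong (+ (m C j) *_)
                                        (coeff-monomial-≢ (sgn j) (j≢d ∘ sym ∘ ℕ.∸-cancelˡ-≡ (ℕ.<⇒≤ d<r) (ℕ.<⇒≤ j<r))))
                                  (ℤ.*-zeroʳ (+ (m C j)))
  ... | tri≈ _ refl _ rewrite <ᵇ-false (ℕ.<-irrefl {d} refl) | ≡ᵇ-true d = begin
    coeff (rev d (χ M)) d
      ≡⟨ trans (coeff-rev-≤ d (χ M) ℕ.≤-refl) (coeff-χ (d ∸ d)) ⟩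
    Σ< d (λ j → + (m C j) * coeff (monomial (sgn j) (d ∸ j)) (d ∸ d)) + coeff (monomial (μ M) 0) (d ∸ d)
      ≡⟨ cong₂ _+_ (Σ<-zero d lower-terms) (cong (coeff (monomial (μ M) 0)) (ℕ.n∸n≡0 d)) ⟩
    + 0 + μ M
      ≡⟨ trans (ℤ.+-identityˡ (μ M)) (μ-uniform M-uniform) ⟩
    μU m d
      ∎
    where
    open ≡-Reasoning
    m : ℕ
    m = ∣ E M ∣
    lower-terms : ∀ j → j < d → + (m C j) * coeff (monomial (sgn j) (d ∸ j)) (d ∸ d) ≡ + 0
    lower-terms j j<d = trans (cong (+ (m C j) *_)
                                    (coeff-monomial-≢ (sgn j) (subst (_≢ d ∸ j) (sym (ℕ.n∸n≡0 d)) (ℕ.<⇒≢ (ℕ.m<n⇒0<n∸m j<d)))))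
                              (ℤ.*-zeroʳ (+ (m C j)))

module _ {N} {M : RawMatroid N} {r} (M-uniform : IsUniform M r) where

  coeff-χ-contract-E : coeff (χ (contract M (E M))) 0 ≡ + 1
  coeff-χ-contract-E = subst (λ k → coeff (rev k (χ (contract M (E M)))) 0 ≡ revχU ∣ E M ─ E M ∣ k 0) (r∸∣E∣≡0 M-uniform)
                             (coeff-revχ (contract-uniform M-uniform (E M) ⊆-refl (inj₂ refl)) 0)

-- Inverse Kazhdan–Lusztig polynomials of uniform matroids

-- Coefficient of t^d in Q_{U_{r,m}} for 2d < r. The second term is absent for d = 0,
-- where truncated subtraction would not make it vanish.
QU : ℕ → ℕ → ℕ → ℤ
QU m r zero    = + ((m ∸ 1) C (r ∸ 1))
QU m r (suc d) = + ((m C suc d) *ℕ ((m ∸ suc d ∸ 1) C (r ∸ suc d ∸ 1))) - + ((m C (r ∸ suc d)) *ℕ ((m ∸ r +ℕ d) C d))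

-- Contribution of the C(m,j) flats of size j < r to the coefficient of t^d in QRHS Q U_{r,m}.
QRHS-term : ℕ → ℕ → ℕ → ℕ → ℤ
QRHS-term m r d j = + (m C j) * (sgn j * revχU (m ∸ j) (r ∸ j) d)

-- With r = d + (s + 1) and m = r + e no truncated subtraction occurs. Flat sizes j ≤ s
-- contribute an alternating binomial sum; of the larger sizes only j = s + 1 = r - d counts.
module QRHS-identity (d s e : ℕ) where

  m r : ℕ
  m = d +ℕ (suc s +ℕ e)
  r = d +ℕ suc s

  terms-below : Σ< (suc s) (QRHS-term m r d) ≡ (sgn d * + (m C d)) * (sgn s * + ((s +ℕ e) C s))
  terms-below = begin
    Σ< (suc s) (QRHS-term m r d)                                    ≡⟨ Σ<-cong (suc s) term≡ ⟩
    Σ< (suc s) (λ j → (sgn d * + (m C d)) * (sgn j * + ((suc s +ℕ e) C j)))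
                                                                    ≡⟨ Σ<-*ˡ (suc s) (sgn d * + (m C d)) _ ⟩
    (sgn d * + (m C d)) * Σ< (suc s) (λ j → sgn j * + ((suc s +ℕ e) C j))
                                                                    ≡⟨ cong ((sgn d * + (m C d)) *_) (Σ-alternating-C (s +ℕ e) s) ⟩
    (sgn d * + (m C d)) * (sgn s * + ((s +ℕ e) C s))                ∎
    where
    open ≡-Reasoning
    term≡ : ∀ j → j < suc s → QRHS-term m r d j ≡ (sgn d * + (m C d)) * (sgn j * + ((suc s +ℕ e) C j))
    term≡ j j<1+s = begin
      + (m C j) * (sgn j * revχU (m ∸ j) (r ∸ j) d)                 ≡⟨ cong (λ c → + (m C j) * (sgn j * c)) (if-true (<ᵇ-true d<r∸j)) ⟩
      + (m C j) * (sgn j * (sgn d * + ((m ∸ j) C d)))               ≡⟨ regroup (+ (m C j)) (+ ((m ∸ j) C d)) (sgn j) (sgn d) ⟩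
      sgn d * (sgn j * (+ (m C j) * + ((m ∸ j) C d)))               ≡⟨ cong (λ c → sgn d * (sgn j * c)) C*C ⟩
      sgn d * (sgn j * (+ (m C d) * + ((suc s +ℕ e) C j)))            ≡⟨ regroup′ (sgn d) (sgn j) (+ (m C d)) (+ ((suc s +ℕ e) C j)) ⟩
      (sgn d * + (m C d)) * (sgn j * + ((suc s +ℕ e) C j))            ∎
      where
      regroup : ∀ a b x y → a * (x * (y * b)) ≡ y * (x * (a * b))
      regroup = solve-∀
      regroup′ : ∀ a b x y → a * (b * (x * y)) ≡ (a * x) * (b * y)
      regroup′ = solve-∀
      d<r∸j : d < r ∸ j
      d<r∸j = subst (d <_) (sym (ℕ.+-∸-assoc d (ℕ.<⇒≤ j<1+s))) (ℕ.m<m+n d (ℕ.m<n⇒0<n∸m j<1+s))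
      j+d≤m : j +ℕ d ≤ m
      j+d≤m = subst (_≤ m) (ℕ.+-comm d j) (ℕ.+-monoʳ-≤ d (ℕ.≤-trans (ℕ.<⇒≤ j<1+s) (ℕ.m≤m+n (suc s) e)))
      C*C : + (m C j) * + ((m ∸ j) C d) ≡ + (m C d) * + ((suc s +ℕ e) C j)
      C*C = begin
        + (m C j) * + ((m ∸ j) C d)               ≡⟨ ℤ.pos-* (m C j) ((m ∸ j) C d) ⟨
        + ((m C j) *ℕ ((m ∸ j) C d))              ≡⟨ cong +_ (mCj*[m∸j]Cd≡mCd*[m∸d]Cj j d j+d≤m) ⟩
        + ((m C d) *ℕ ((m ∸ d) C j))              ≡⟨ cong (λ n → + ((m C d) *ℕ (n C j))) (ℕ.m+n∸m≡n d (suc s +ℕ e)) ⟩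
        + ((m C d) *ℕ ((suc s +ℕ e) C j))           ≡⟨ ℤ.pos-* (m C d) ((suc s +ℕ e) C j) ⟩
        + (m C d) * + ((suc s +ℕ e) C j)            ∎

  term-at : ∀ d′ → d ≡ suc d′ → QRHS-term m r d (suc s) ≡ + (m C suc s) * (sgn (suc s) * (sgn d * + ((d′ +ℕ e) C d′)))
  term-at d′ refl = cong (λ c → + (m C suc s) * (sgn (suc s) * c)) (begin
    revχU (m ∸ suc s) (r ∸ suc s) d      ≡⟨ cong₂ (λ x y → revχU x y d) m∸1+s≡d+e (ℕ.m+n∸n≡m d (suc s)) ⟩
    revχU (d +ℕ e) d d                    ≡⟨ trans (if-false (<ᵇ-false (ℕ.<-irrefl {d} refl))) (if-true (≡ᵇ-true d)) ⟩
    μU (d +ℕ e) d                         ∎)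
    where
    open ≡-Reasoning
    m∸1+s≡d+e : m ∸ suc s ≡ d +ℕ e
    m∸1+s≡d+e = trans (cong (_∸ suc s) (exchange d (suc s) e)) (ℕ.m+n∸m≡n (suc s) (d +ℕ e))
      where
      exchange : ∀ a b c → a +ℕ (b +ℕ c) ≡ b +ℕ (a +ℕ c)
      exchange = ℕSolver.solve-∀

  terms-above : ∀ t → 0 < t → t < d → QRHS-term m r d (suc s +ℕ t) ≡ + 0
  terms-above t 0<t t<d = trans (cong (λ c → + (m C (suc s +ℕ t)) * (sgn (suc s +ℕ t) * c)) revχU≡0)
                                (trans (cong (+ (m C (suc s +ℕ t)) *_) (ℤ.*-zeroʳ (sgn (suc s +ℕ t))))
                                       (ℤ.*-zeroʳ (+ (m C (suc s +ℕ t)))))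
    where
    r∸[1+s+t]≡d∸t : r ∸ (suc s +ℕ t) ≡ d ∸ t
    r∸[1+s+t]≡d∸t = trans (cong (_∸ (suc s +ℕ t)) (ℕ.+-comm d (suc s))) (ℕ.[m+n]∸[m+o]≡n∸o (suc s) d t)
    d∸t<d : d ∸ t < d
    d∸t<d = ℕ.∸-monoʳ-< 0<t (ℕ.<⇒≤ t<d)
    revχU≡0 : revχU (m ∸ (suc s +ℕ t)) (r ∸ (suc s +ℕ t)) d ≡ + 0
    revχU≡0 rewrite r∸[1+s+t]≡d∸t = trans (if-false (<ᵇ-false (ℕ.<-asym d∸t<d))) (if-false (≡ᵇ-false (ℕ.>⇒≢ d∸t<d)))

Σ-QRHS-term-vanishes′ : ∀ d s e → let open QRHS-identity d s e in Σ< r (QRHS-term m r d) + sgn r * QU m r d ≡ + 0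
Σ-QRHS-term-vanishes′ zero s e =
  trans (cong (_+ sgn (suc s) * QU m r 0) terms-below) (cancel (sgn s) (+ ((s +ℕ e) C s)))
  where
  open QRHS-identity zero s e
  cancel : ∀ a x → + 1 * + 1 * (a * x) + (- a) * x ≡ + 0
  cancel = solve-∀
Σ-QRHS-term-vanishes′ d@(suc d′) s e = begin
  Σ< r (QRHS-term m r d) + sgn r * QU m r d
    ≡⟨ cong (λ n → Σ< n (QRHS-term m r d) + sgn r * QU m r d) (ℕ.+-comm d (suc s)) ⟩
  Σ< (suc s +ℕ d) (QRHS-term m r d) + sgn r * QU m r d
    ≡⟨ cong (_+ sgn r * QU m r d) (Σ<-split (suc s) d (QRHS-term m r d)) ⟩
  Σ< (suc s) (QRHS-term m r d) + Σ< d (λ t → QRHS-term m r d (suc s +ℕ t)) + sgn r * QU m r d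
    ≡⟨ cong₂ (λ a b → a + b + sgn r * QU m r d) terms-below terms-from-r∸d ⟩
  (sgn d * + B₁) * (sgn s * + X) + + B₂ * (sgn (suc s) * (sgn d * + X′)) + sgn r * QU m r d
    ≡⟨ cong (λ z → (sgn d * + B₁) * (sgn s * + X) + + B₂ * (sgn (suc s) * (sgn d * + X′)) + z)
            (cong₂ _*_ (sgn-+ d (suc s)) QU≡) ⟩
  (sgn d * + B₁) * (sgn s * + X) + + B₂ * (sgn (suc s) * (sgn d * + X′)) + (sgn d * sgn (suc s)) * (+ B₁ * + X - + B₂ * + X′)
    ≡⟨ cancel (sgn d′) (sgn s) (+ X) (+ X′) (+ B₁) (+ B₂) ⟩
  + 0
    ∎
  where
  open QRHS-identity d s e
  open ≡-Reasoning
  B₁ B₂ X X′ : ℕ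
  B₁ = m C d
  B₂ = m C suc s
  X  = (s +ℕ e) C s
  X′ = (d′ +ℕ e) C d′
  terms-from-r∸d : Σ< d (λ t → QRHS-term m r d (suc s +ℕ t)) ≡ + B₂ * (sgn (suc s) * (sgn d * + X′))
  terms-from-r∸d = trans (Σ<-single d 0 _ (s≤s z≤n) (λ t t<d t≢0 → terms-above t (ℕ.n≢0⇒n>0 t≢0) t<d))
                         (trans (cong (QRHS-term m r d) (ℕ.+-identityʳ (suc s))) (term-at d′ refl))
  m∸d≡1+s+e : m ∸ d ≡ suc s +ℕ e
  m∸d≡1+s+e = ℕ.m+n∸m≡n d (suc s +ℕ e)
  r∸d≡1+s : r ∸ d ≡ suc s
  r∸d≡1+s = ℕ.m+n∸m≡n d (suc s)
  m∸r≡e : m ∸ r ≡ e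
  m∸r≡e = trans (cong (_∸ r) (sym (ℕ.+-assoc d (suc s) e))) (ℕ.m+n∸m≡n r e)
  QU≡ : QU m r d ≡ + B₁ * + X - + B₂ * + X′
  QU≡ = trans (cong₂ (λ a b → + (B₁ *ℕ a) - + b)
                     (cong₂ (λ a b → (a ∸ 1) C (b ∸ 1)) m∸d≡1+s+e r∸d≡1+s)
                     (cong₂ (λ a b → (m C a) *ℕ (b C d′)) r∸d≡1+s (trans (cong (_+ℕ d′) m∸r≡e) (ℕ.+-comm e d′))))
              (cong₂ _-_ (ℤ.pos-* B₁ X) (ℤ.pos-* B₂ X′))
  cancel : ∀ a b x y c₁ c₂ → ((- a) * c₁) * (b * x) + c₂ * ((- b) * ((- a) * y)) + ((- a) * (- b)) * (c₁ * x - c₂ * y) ≡ + 0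
  cancel = solve-∀

Σ-QRHS-term-vanishes : ∀ {m r d} → d < r → r ≤ m → Σ< r (QRHS-term m r d) + sgn r * QU m r d ≡ + 0
Σ-QRHS-term-vanishes {m} {r} {d} d<r r≤m =
  subst₂ (λ m r → Σ< r (QRHS-term m r d) + sgn r * QU m r d ≡ + 0) m≡ r≡ (Σ-QRHS-term-vanishes′ d s e)
  where
  s : ℕ
  s = r ∸ suc d
  e : ℕ
  e = m ∸ r
  r≡ : d +ℕ suc s ≡ r
  r≡ = trans (ℕ.+-suc d s) (ℕ.m+[n∸m]≡n d<r)
  m≡ : d +ℕ (suc s +ℕ e) ≡ m
  m≡ = trans (sym (ℕ.+-assoc d (suc s) e)) (trans (cong (_+ℕ e) r≡) (ℕ.m+[n∸m]≡n r≤m))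

QU-diagonal : ∀ m i → i < m → QU m m i ≡ coeff oneₚ i
QU-diagonal m zero    _     = cong +_ (nCn≡1 (m ∸ 1))
QU-diagonal m (suc d) 1+d<m = begin
  + ((m C suc d) *ℕ ((m ∸ suc d ∸ 1) C (m ∸ suc d ∸ 1))) - + ((m C (m ∸ suc d)) *ℕ ((m ∸ m +ℕ d) C d))
    ≡⟨ cong₂ (λ a b → + ((m C suc d) *ℕ a) - + ((m C (m ∸ suc d)) *ℕ b))
             (nCn≡1 (m ∸ suc d ∸ 1)) (trans (cong (λ k → (k +ℕ d) C d) (ℕ.n∸n≡0 m)) (nCn≡1 d)) ⟩
  + ((m C suc d) *ℕ 1) - + ((m C (m ∸ suc d)) *ℕ 1)
    ≡⟨ cong (λ c → + ((m C suc d) *ℕ 1) - + (c *ℕ 1)) (nCk≡nC[n∸k] (ℕ.<⇒≤ 1+d<m)) ⟨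
  + ((m C suc d) *ℕ 1) - + ((m C suc d) *ℕ 1)
    ≡⟨ ℤ.+-inverseʳ (+ ((m C suc d) *ℕ 1)) ⟩
  + 0
    ∎
  where open ≡-Reasoning

module _ (Q : ∀ {N} → RawMatroid N → Poly) where

  module _ {N} {M : RawMatroid N} {r} (M-uniform : IsUniform M r) where

    open IsUniform M-uniform

    coeff-Σ-flats-Q : ∀ (P : Subset N → Poly) (p : ℕ → ℤ) i →
      (∀ F → F ⊆ E M → ∣ F ∣ < r → Q (restrict M F) ≈ₚ oneₚ) →
      (∀ F → F ⊆ E M → ∣ F ∣ < r → coeff (P F) i ≡ p ∣ F ∣) →
      coeff (sumₚ (map (λ F → scale (sgn (rk M F)) (Q (restrict M F) *ₚ P F)) (flats M))) i
      ≡ Σ< r (λ j → + (∣ E M ∣ C j) * (sgn j * p j)) + sgn r * coeff (Q M *ₚ P (E M)) i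
    coeff-Σ-flats-Q P p i Q-flat≈1 coeff-P =
      trans (coeff-sumₚ (λ F → scale (sgn (rk M F)) (Q (restrict M F) *ₚ P F)) (flats M) i)
            (trans (Σ-flats-by-size M-uniform _ (λ j → sgn j * p j) per-flat)
                   (cong (λ z → Σ< r (λ j → + (∣ E M ∣ C j) * (sgn j * p j)) + z) top))
      where
      per-flat : ∀ F → F ⊆ E M → ∣ F ∣ < r →
                 coeff (scale (sgn (rk M F)) (Q (restrict M F) *ₚ P F)) i ≡ sgn ∣ F ∣ * p ∣ F ∣
      per-flat F F⊆E ∣F∣<r = begin
        coeff (scale (sgn (rk M F)) (Q (restrict M F) *ₚ P F)) i   ≡⟨ coeff-scale (sgn (rk M F)) (Q (restrict M F) *ₚ P F) i ⟩
        sgn (rk M F) * coeff (Q (restrict M F) *ₚ P F) i           ≡⟨ cong₂ (λ k c → sgn k * c) (rk-flat M-uniform F⊆E ∣F∣<r)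
                                                                             (coeff-*ₚ-≈oneₚ (Q (restrict M F)) (P F) i (Q-flat≈1 F F⊆E ∣F∣<r)) ⟩
        sgn ∣ F ∣ * coeff (P F) i                                   ≡⟨ cong (sgn ∣ F ∣ *_) (coeff-P F F⊆E ∣F∣<r) ⟩
        sgn ∣ F ∣ * p ∣ F ∣                                         ∎
        where open ≡-Reasoning
      top : coeff (scale (sgn (rk M (E M))) (Q M *ₚ P (E M))) i ≡ sgn r * coeff (Q M *ₚ P (E M)) i
      top = trans (coeff-scale (sgn (rank M)) (Q M *ₚ P (E M)) i)
                  (cong (λ k → sgn k * coeff (Q M *ₚ P (E M)) i) (rank-uniform M-uniform))

    coeff-QRHS-uniform : (∀ F → F ⊆ E M → ∣ F ∣ < r → Q (restrict M F) ≈ₚ oneₚ) →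
                         ∀ d → coeff (QRHS Q M) d ≡ Σ< r (QRHS-term ∣ E M ∣ r d) + sgn r * coeff (Q M) d
    coeff-QRHS-uniform Q-flat≈1 d =
      trans (coeff-Σ-flats-Q _ (λ j → revχU (m ∸ j) (r ∸ j) d) d Q-flat≈1 per-flat)
            (cong (λ z → Σ< r (QRHS-term m r d) + sgn r * z) top)
      where
      m : ℕ
      m = ∣ E M ∣
      per-flat : ∀ F → F ⊆ E M → ∣ F ∣ < r →
                 coeff (rev (rank (contract M F)) (χ (contract M F))) d ≡ revχU (m ∸ ∣ F ∣) (r ∸ ∣ F ∣) d
      per-flat F F⊆E ∣F∣<r = begin
        coeff (rev (rank (contract M F)) (χ (contract M F))) d
          ≡⟨ cong (λ k → coeff (rev k (χ (contract M F))) d) (rank-contract-flat M-uniform F⊆E ∣F∣<r) ⟩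
        coeff (rev (r ∸ ∣ F ∣) (χ (contract M F))) d
          ≡⟨ coeff-revχ (contract-uniform M-uniform F F⊆E (inj₁ ∣F∣<r)) d ⟩
        revχU ∣ E M ─ F ∣ (r ∸ ∣ F ∣) d
          ≡⟨ cong (λ n → revχU n (r ∸ ∣ F ∣) d) (∣p─q∣≡∣p∣∸∣q∣ (E M) F F⊆E) ⟩
        revχU (m ∸ ∣ F ∣) (r ∸ ∣ F ∣) d
          ∎
        where open ≡-Reasoning
      top : coeff (Q M *ₚ rev (rank (contract M (E M))) (χ (contract M (E M)))) d ≡ coeff (Q M) d
      top = begin
        coeff (Q M *ₚ rev (rank (contract M (E M))) (χ (contract M (E M)))) d
          ≡⟨ cong (λ k → coeff (Q M *ₚ rev k (χ (contract M (E M)))) d) (rank-contract-E M-uniform) ⟩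
        coeff (Q M *ₚ (coeff (χ (contract M (E M))) 0 ∷ [])) d
          ≡⟨ coeff-*ₚ-constant (Q M) _ d ⟩
        coeff (χ (contract M (E M))) 0 * coeff (Q M) d
          ≡⟨ cong (_* coeff (Q M) d) (coeff-χ-contract-E M-uniform) ⟩
        + 1 * coeff (Q M) d
          ≡⟨ ℤ.*-identityˡ (coeff (Q M) d) ⟩
        coeff (Q M) d
          ∎
        where open ≡-Reasoning

  module _ (Q-inverseKL : IsInverseKL Q) where

    open IsInverseKL Q-inverseKL

    module _ {N} {M : RawMatroid N} {r} (M-uniform : IsUniform M r) (0<r : 0 < r) where

      open IsUniform M-uniform

      coeff-Q-high : ∀ d → r ≤ 2 *ℕ d → coeff (Q M) d ≡ + 0
      coeff-Q-high d r≤2d = degree M (uniform-isMatroid M-uniform) (uniform-loopless M-uniform)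
                                   (subst (0 <_) (sym (rank-uniform M-uniform)) 0<r) d
                                   (subst (_≤ 2 *ℕ d) (sym (rank-uniform M-uniform)) r≤2d)

      coeff-signed-rev-Q-low : ∀ d → 2 *ℕ d < r → coeff (scale (sgn (rank M)) (rev (rank M) (Q M))) d ≡ + 0
      coeff-signed-rev-Q-low d 2d<r rewrite rank-uniform M-uniform = begin
        coeff (scale (sgn r) (rev r (Q M))) d    ≡⟨ coeff-scale (sgn r) (rev r (Q M)) d ⟩
        sgn r * coeff (rev r (Q M)) d            ≡⟨ cong (sgn r *_) (coeff-rev-≤ r (Q M) (ℕ.<⇒≤ (ℕ.≤-<-trans (ℕ.m≤n*m d 2) 2d<r))) ⟩
        sgn r * coeff (Q M) (r ∸ d)              ≡⟨ cong (sgn r *_) (coeff-Q-high (r ∸ d) r≤2[r∸d]) ⟩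
        sgn r * + 0                              ≡⟨ ℤ.*-zeroʳ (sgn r) ⟩
        + 0                                      ∎
        where
        open ≡-Reasoning
        r≤2[r∸d] : r ≤ 2 *ℕ (r ∸ d)
        r≤2[r∸d] = subst (r ≤_) (sym (ℕ.*-distribˡ-∸ 2 r d))
                         (ℕ.m+n≤o⇒m≤o∸n r (subst (r +ℕ 2 *ℕ d ≤_) (cong (r +ℕ_) (sym (ℕ.+-identityʳ r)))
                                                 (ℕ.+-monoʳ-≤ r (ℕ.<⇒≤ 2d<r))))

      -- Compare coefficients of t^d in the defining equation: the left side vanishes as
      -- deg Q < r/2, the right side is S + (-1)^r Q_d (coeff-QRHS-uniform), and S + (-1)^r QU = 0.
      coeff-Q-low : (∀ F → F ⊆ E M → ∣ F ∣ < r → Q (restrict M F) ≈ₚ oneₚ) →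
                    ∀ d → 2 *ℕ d < r → coeff (Q M) d ≡ QU ∣ E M ∣ r d
      coeff-Q-low Q-flat≈1 d 2d<r = +-sgn-cancelˡ S r (coeff (Q M) d) (QU m r d) (begin
        S + sgn r * coeff (Q M) d                               ≡⟨ coeff-QRHS-uniform M-uniform Q-flat≈1 d ⟨
        coeff (QRHS Q M) d                                      ≡⟨ equation M (uniform-isMatroid M-uniform) (uniform-loopless M-uniform) d ⟨
        coeff (scale (sgn (rank M)) (rev (rank M) (Q M))) d     ≡⟨ coeff-signed-rev-Q-low d 2d<r ⟩
        + 0                                                     ≡⟨ Σ-QRHS-term-vanishes (ℕ.≤-<-trans (ℕ.m≤n*m d 2) 2d<r) r≤∣E∣ ⟨
        S + sgn r * QU m r d                                    ∎)
        where
        open ≡-Reasoning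
        m : ℕ
        m = ∣ E M ∣
        S : ℤ
        S = Σ< r (QRHS-term m r d)

    -- Strong induction on ∣E∣: the proper flats of a Boolean matroid are Boolean, and QU m m = 1.
    Q-boolean : ∀ {N} {M : RawMatroid N} → IsUniform M ∣ E M ∣ → Q M ≈ₚ oneₚ
    Q-boolean {M = M} M-boolean = <-rec Boolean⇒Q≈1 step ∣ E M ∣ M-boolean refl
      where
      Boolean⇒Q≈1 : ℕ → Set
      Boolean⇒Q≈1 n = ∀ {N} {M : RawMatroid N} → IsUniform M ∣ E M ∣ → ∣ E M ∣ ≡ n → Q M ≈ₚ oneₚ
      step : ∀ n → (∀ {k} → k < n → Boolean⇒Q≈1 k) → Boolean⇒Q≈1 n
      step _ smaller {M = M} M-boolean refl i with ∣ E M ∣ ℕ.≟ 0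
      ... | yes ∣E∣≡0 = rank0 M (uniform-isMatroid M-boolean) (uniform-loopless M-boolean)
                              (trans (rank-uniform M-boolean) ∣E∣≡0) i
      ... | no ∣E∣≢0 with 2 *ℕ i ℕ.<? ∣ E M ∣
      ...   | yes 2i<∣E∣ = trans (coeff-Q-low M-boolean 0<∣E∣ proper-flats i 2i<∣E∣)
                                 (QU-diagonal ∣ E M ∣ i (ℕ.≤-<-trans (ℕ.m≤n*m i 2) 2i<∣E∣))
        where
        0<∣E∣ : 0 < ∣ E M ∣
        0<∣E∣ = ℕ.n≢0⇒n>0 ∣E∣≢0
        proper-flats : ∀ F → F ⊆ E M → ∣ F ∣ < ∣ E M ∣ → Q (restrict M F) ≈ₚ oneₚ
        proper-flats F F⊆E ∣F∣<∣E∣ = smaller ∣F∣<∣E∣ (restrict-uniform M-boolean F F⊆E (ℕ.<⇒≤ ∣F∣<∣E∣)) refl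
      ...   | no 2i≮∣E∣ = trans (coeff-Q-high M-boolean (ℕ.n≢0⇒n>0 ∣E∣≢0) i (ℕ.≮⇒≥ 2i≮∣E∣)) (sym (coeff-oneₚ-high i 2i≮∣E∣))
        where
        coeff-oneₚ-high : ∀ i → ¬ 2 *ℕ i < ∣ E M ∣ → coeff oneₚ i ≡ + 0
        coeff-oneₚ-high zero    2i≮∣E∣ = contradiction (ℕ.n≢0⇒n>0 ∣E∣≢0) 2i≮∣E∣
        coeff-oneₚ-high (suc i) _      = refl

    coeff-Q-uniform : ∀ {N} {M : RawMatroid N} {r} → IsUniform M r → 0 < r →
                      ∀ d → coeff (Q M) d ≡ (if 2 *ℕ d <ᵇ r then QU ∣ E M ∣ r d else + 0)
    coeff-Q-uniform {M = M} {r} M-uniform 0<r d with 2 *ℕ d ℕ.<? r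
    ... | yes 2d<r = trans (coeff-Q-low M-uniform 0<r proper-flats d 2d<r) (sym (if-true (<ᵇ-true 2d<r)))
      where
      proper-flats : ∀ F → F ⊆ E M → ∣ F ∣ < r → Q (restrict M F) ≈ₚ oneₚ
      proper-flats F F⊆E ∣F∣<r = Q-boolean (restrict-uniform M-uniform F F⊆E (ℕ.<⇒≤ ∣F∣<r))
    ... | no 2d≮r = trans (coeff-Q-high M-uniform 0<r d (ℕ.≮⇒≥ 2d≮r)) (sym (if-false (<ᵇ-false 2d≮r)))

-- The inverse Z-polynomial of a uniform matroid

-- Contribution of the C(m,j) flats of size j < r to the coefficient of t^i in Ŷ Q U_{r,m}.
Ŷ-term : ℕ → ℕ → ℕ → ℕ → ℤ
Ŷ-term m r i j = + (m C j) * (sgn j * coeff (monomial (μU (m ∸ j) (r ∸ j)) (r ∸ j)) i)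

module _ (Q : ∀ {N} → RawMatroid N → Poly) (Q-inverseKL : IsInverseKL Q) where

  coeff-Y-uniform : ∀ {N} {M : RawMatroid N} {r} → IsUniform M r →
                    ∀ i → coeff (Y Q M) i ≡ sgn r * Σ< r (Ŷ-term ∣ E M ∣ r i) + coeff (Q M) i
  coeff-Y-uniform {M = M} {r} M-uniform i = begin
    coeff (Y Q M) i
      ≡⟨ coeff-scale (sgn (rank M)) (Ŷ Q M) i ⟩
    sgn (rank M) * coeff (Ŷ Q M) i
      ≡⟨ cong₂ (λ k c → sgn k * c) (rank-uniform M-uniform)
               (coeff-Σ-flats-Q Q M-uniform _ (λ j → coeff (monomial (μU (m ∸ j) (r ∸ j)) (r ∸ j)) i) i proper-flats per-flat) ⟩
    sgn r * (Σ< r (Ŷ-term m r i) + sgn r * coeff (Q M *ₚ monomial (μ (contract M (E M))) (rank (contract M (E M)))) i)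
      ≡⟨ cong (λ z → sgn r * (Σ< r (Ŷ-term m r i) + sgn r * z)) top ⟩
    sgn r * (Σ< r (Ŷ-term m r i) + sgn r * coeff (Q M) i)
      ≡⟨ trans (ℤ.*-distribˡ-+ (sgn r) _ _) (cong (λ z → sgn r * Σ< r (Ŷ-term m r i) + z) (sgn*sgn*x≡x r (coeff (Q M) i))) ⟩
    sgn r * Σ< r (Ŷ-term m r i) + coeff (Q M) i
      ∎
    where
    open ≡-Reasoning
    m : ℕ
    m = ∣ E M ∣
    proper-flats : ∀ F → F ⊆ E M → ∣ F ∣ < r → Q (restrict M F) ≈ₚ oneₚ
    proper-flats F F⊆E ∣F∣<r = Q-boolean Q Q-inverseKL (restrict-uniform M-uniform F F⊆E (ℕ.<⇒≤ ∣F∣<r))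
    per-flat : ∀ F → F ⊆ E M → ∣ F ∣ < r → coeff (monomial (μ (contract M F)) (rank (contract M F))) i
                                           ≡ coeff (monomial (μU (m ∸ ∣ F ∣) (r ∸ ∣ F ∣)) (r ∸ ∣ F ∣)) i
    per-flat F F⊆E ∣F∣<r = cong₂ (λ c d → coeff (monomial c d) i) (μ-contract-flat M-uniform F⊆E ∣F∣<r)
                                                                 (rank-contract-flat M-uniform F⊆E ∣F∣<r)
    top : coeff (Q M *ₚ monomial (μ (contract M (E M))) (rank (contract M (E M)))) i ≡ coeff (Q M) i
    top = trans (cong₂ (λ c d → coeff (Q M *ₚ monomial c d) i) (μ-contract-E M-uniform) (rank-contract-E M-uniform))
                (trans (coeff-*ₚ-constant (Q M) (+ 1) i) (ℤ.*-identityˡ (coeff (Q M) i)))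

[m∸o]∸[n∸o]≡m∸n : ∀ {m n o} → o ≤ n → m ∸ o ∸ (n ∸ o) ≡ m ∸ n
[m∸o]∸[n∸o]≡m∸n {m}     {n}     {zero}  _         = refl
[m∸o]∸[n∸o]≡m∸n {zero}  {suc n} {suc o} (s≤s o≤n) = ℕ.0∸n≡0 (n ∸ o)
[m∸o]∸[n∸o]≡m∸n {suc m} {suc n} {suc o} (s≤s o≤n) = [m∸o]∸[n∸o]≡m∸n o≤n

n∸[k∸i]≡n∸k+i : ∀ {n k i} → i ≤ k → k ≤ n → n ∸ (k ∸ i) ≡ n ∸ k +ℕ i
n∸[k∸i]≡n∸k+i {n} {k} {i} i≤k k≤n = begin
  n ∸ (k ∸ i)                              ≡⟨ cong (_∸ (k ∸ i)) n≡ ⟩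
  (k ∸ i) +ℕ (n ∸ k +ℕ i) ∸ (k ∸ i)        ≡⟨ ℕ.m+n∸m≡n (k ∸ i) (n ∸ k +ℕ i) ⟩
  n ∸ k +ℕ i                               ∎
  where
  open ≡-Reasoning
  exchange : ∀ x y z → x +ℕ (y +ℕ z) ≡ y +ℕ (x +ℕ z)
  exchange = ℕSolver.solve-∀
  n≡ : n ≡ (k ∸ i) +ℕ (n ∸ k +ℕ i)
  n≡ = trans (sym (ℕ.m+[n∸m]≡n k≤n)) (trans (ℕ.+-comm k (n ∸ k))
         (trans (cong (n ∸ k +ℕ_) (sym (ℕ.m∸n+n≡m i≤k))) (exchange (n ∸ k) (k ∸ i) i)))

n∸[k∸1-d]∸1≡n∸k+d : ∀ {k n} d → suc d ≤ k → k ≤ n → n ∸ (k ∸ suc d) ∸ 1 ≡ n ∸ k +ℕ d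
n∸[k∸1-d]∸1≡n∸k+d {k} {n} d 1+d≤k k≤n =
  trans (cong (_∸ 1) (n∸[k∸i]≡n∸k+i 1+d≤k k≤n)) (cong (_∸ 1) (ℕ.+-suc (n ∸ k) d))

binomTerm-complement : ∀ {k n} d → suc d ≤ k → k ≤ n →
                       binomTerm k n (k ∸ suc d) ≡ + ((n C (k ∸ suc d)) *ℕ ((n ∸ k +ℕ d) C d))
binomTerm-complement {k} {n} d 1+d≤k k≤n =
  cong (λ c → + ((n C (k ∸ suc d)) *ℕ c))
       (trans (cong (_C (n ∸ k)) (n∸[k∸1-d]∸1≡n∸k+d d 1+d≤k k≤n)) (C[a+b]a≡C[a+b]b (n ∸ k) d))

QU≡binomTerm-0 : ∀ {k n} → 0 < k → k ≤ n → QU n k 0 ≡ binomTerm k n 0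
QU≡binomTerm-0 {suc k} {suc n} _ (s≤s k≤n) =
  cong +_ (trans (nCk≡nC[n∸k] k≤n) (sym (ℕ.*-identityˡ (n C (n ∸ k)))))

QU≡binomTerm-difference : ∀ {k n i} → 0 < i → i < k → k ≤ n → QU n k i ≡ binomTerm k n i - binomTerm k n (k ∸ i)
QU≡binomTerm-difference {k} {n} {suc d} _ 1+d<k k≤n =
  cong₂ (λ x y → + ((n C suc d) *ℕ x) - y)
        (trans (nCk≡nC[n∸k] (ℕ.∸-monoˡ-≤ 1 (ℕ.∸-monoˡ-≤ (suc d) k≤n))) (cong ((n ∸ suc d ∸ 1) C_) complement))
        (sym (binomTerm-complement d (ℕ.<⇒≤ 1+d<k) k≤n))
  where
  complement : n ∸ suc d ∸ 1 ∸ (k ∸ suc d ∸ 1) ≡ n ∸ k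
  complement = begin
    n ∸ suc d ∸ 1 ∸ (k ∸ suc d ∸ 1)     ≡⟨ cong₂ _∸_ (ℕ.∸-+-assoc n (suc d) 1) (ℕ.∸-+-assoc k (suc d) 1) ⟩
    n ∸ (suc d +ℕ 1) ∸ (k ∸ (suc d +ℕ 1)) ≡⟨ [m∸o]∸[n∸o]≡m∸n (subst (_≤ k) (ℕ.+-comm 1 (suc d)) 1+d<k) ⟩
    n ∸ k                                 ∎
    where open ≡-Reasoning

Ŷ-term-vanishes : ∀ m r i j → r ∸ j ≢ i → Ŷ-term m r i j ≡ + 0
Ŷ-term-vanishes m r i j r∸j≢i = begin
  + (m C j) * (sgn j * coeff (monomial (μU (m ∸ j) (r ∸ j)) (r ∸ j)) i)
    ≡⟨ cong (λ c → + (m C j) * (sgn j * c)) (coeff-monomial-≢ (μU (m ∸ j) (r ∸ j)) (r∸j≢i ∘ sym)) ⟩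
  + (m C j) * (sgn j * + 0)
    ≡⟨ trans (cong (+ (m C j) *_) (ℤ.*-zeroʳ (sgn j))) (ℤ.*-zeroʳ (+ (m C j))) ⟩
  + 0
    ∎
  where open ≡-Reasoning

Σ-Ŷ-term-miss : ∀ {m r i} → (∀ j → j < r → r ∸ j ≢ i) → Σ< r (Ŷ-term m r i) ≡ + 0
Σ-Ŷ-term-miss {m} {r} {i} miss = Σ<-zero r (λ j j<r → Ŷ-term-vanishes m r i j (miss j j<r))

sgn-Σ-Ŷ-term : ∀ {k n i} → 0 < i → i ≤ k → k ≤ n → sgn k * Σ< k (Ŷ-term n k i) ≡ binomTerm k n (k ∸ i)
sgn-Σ-Ŷ-term {k} {n} {i@(suc d)} _ i≤k k≤n = begin
  sgn k * Σ< k (Ŷ-term n k i)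
    ≡⟨ cong (sgn k *_) (Σ<-single k a (Ŷ-term n k i) a<k other-terms) ⟩
  sgn k * (+ (n C a) * (sgn a * coeff (monomial (μU (n ∸ a) (k ∸ a)) (k ∸ a)) i))
    ≡⟨ cong (λ c → sgn k * (+ (n C a) * (sgn a * c))) (trans (cong (λ e → coeff (monomial (μU (n ∸ a) e) e) i) k∸a≡i)
                                                             (coeff-monomial-≡ (μU (n ∸ a) i) i)) ⟩
  sgn k * (+ (n C a) * (sgn a * (sgn i * + ((n ∸ a ∸ 1) C d))))
    ≡⟨ cong₂ (λ s x → s * (+ (n C a) * (sgn a * (sgn i * + (x C d))))) sgn-k (n∸[k∸1-d]∸1≡n∸k+d d i≤k k≤n) ⟩
  (sgn a * sgn i) * (+ (n C a) * (sgn a * (sgn i * + X)))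
    ≡⟨ regroup (sgn a) (sgn i) (+ (n C a)) (+ X) ⟩
  (sgn a * sgn a) * (sgn i * sgn i) * (+ (n C a) * + X)
    ≡⟨ cong₂ (λ s t → s * t * (+ (n C a) * + X)) (sgn*sgn≡1 a) (sgn*sgn≡1 i) ⟩
  + 1 * + 1 * (+ (n C a) * + X)
    ≡⟨ trans (ℤ.*-identityˡ _) (sym (ℤ.pos-* (n C a) X)) ⟩
  + ((n C a) *ℕ X)
    ≡⟨ binomTerm-complement d i≤k k≤n ⟨
  binomTerm k n a
    ∎
  where
  open ≡-Reasoning
  a : ℕ
  a = k ∸ suc d
  X : ℕ
  X = (n ∸ k +ℕ d) C d
  a<k : a < k
  a<k = ℕ.∸-monoʳ-< (s≤s z≤n) i≤k
  k∸a≡i : k ∸ a ≡ i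
  k∸a≡i = ℕ.m∸[m∸n]≡n i≤k
  sgn-k : sgn k ≡ sgn a * sgn i
  sgn-k = trans (cong sgn (sym (ℕ.m∸n+n≡m i≤k))) (sgn-+ a i)
  other-terms : ∀ j → j < k → j ≢ a → Ŷ-term n k i j ≡ + 0
  other-terms j j<k j≢a = Ŷ-term-vanishes n k i j (λ k∸j≡i → j≢a (trans (sym (ℕ.m∸[m∸n]≡n (ℕ.<⇒≤ j<k))) (cong (k ∸_) k∸j≡i)))
  regroup : ∀ x y c z → (x * y) * (c * (x * (y * z))) ≡ (x * x) * (y * y) * (c * z)
  regroup = solve-∀

coeff-formula : ∀ k n i → coeff (formula k n) i ≡
  Σ< (suc ⌊ k /2⌋) (λ x → coeff (monomial (binomTerm k n x) x) i)
  + Σ< (suc ⌊ (k ∸ 1) /2⌋) (λ x → coeff (monomial (binomTerm k n x) (k ∸ x)) i)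
coeff-formula k n i = trans (coeff-+ₚ (sumₚ (map (λ x → monomial (binomTerm k n x) x) (upTo (suc ⌊ k /2⌋)))) _ i)
                            (cong₂ _+_ (Σ-monomials (λ x → x) (suc ⌊ k /2⌋)) (Σ-monomials (k ∸_) (suc ⌊ (k ∸ 1) /2⌋)))
  where
  Σ-monomials : ∀ (e : ℕ → ℕ) N → coeff (sumₚ (map (λ x → monomial (binomTerm k n x) (e x)) (upTo N))) i
                                  ≡ Σ< N (λ x → coeff (monomial (binomTerm k n x) (e x)) i)
  Σ-monomials e N = trans (coeff-sumₚ (λ x → monomial (binomTerm k n x) (e x)) (upTo N) i)
                          (sumℤ-upTo (λ x → coeff (monomial (binomTerm k n x) (e x)) i) N)

Σ-monomials-id-hit : ∀ N (f : ℕ → ℤ) {i} → i < N → Σ< N (λ x → coeff (monomial (f x) x) i) ≡ f i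
Σ-monomials-id-hit N f {i} i<N = Σ-coeff-monomial-hit N f id i i<N refl (λ _ _ y≡i → y≡i)

Σ-monomials-id-miss : ∀ N (f : ℕ → ℤ) {i} → N ≤ i → Σ< N (λ x → coeff (monomial (f x) x) i) ≡ + 0
Σ-monomials-id-miss N f N≤i = Σ-coeff-monomial-miss N f id (λ y y<N y≡i → ℕ.<⇒≱ y<N (subst (N ≤_) (sym y≡i) N≤i))

Σ-monomials-rev-hit : ∀ N k (f : ℕ → ℤ) {i} → N ≤ k → i ≤ k → k ∸ i < N →
                      Σ< N (λ x → coeff (monomial (f x) (k ∸ x)) i) ≡ f (k ∸ i)
Σ-monomials-rev-hit N k f {i} N≤k i≤k k∸i<N =
  Σ-coeff-monomial-hit N f (k ∸_) (k ∸ i) k∸i<N (ℕ.m∸[m∸n]≡n i≤k)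
    (λ y y<N k∸y≡i → trans (sym (ℕ.m∸[m∸n]≡n (ℕ.<⇒≤ (ℕ.<-≤-trans y<N N≤k)))) (cong (k ∸_) k∸y≡i))

Σ-monomials-rev-miss : ∀ N k (f : ℕ → ℤ) {i} → N ≤ k → k < i ⊎ N ≤ k ∸ i →
                       Σ< N (λ x → coeff (monomial (f x) (k ∸ x)) i) ≡ + 0
Σ-monomials-rev-miss N k f {i} N≤k beyond = Σ-coeff-monomial-miss N f (k ∸_) (miss beyond)
  where
  miss : k < i ⊎ N ≤ k ∸ i → ∀ y → y < N → k ∸ y ≢ i
  miss (inj₁ k<i)   y y<N k∸y≡i = ℕ.<⇒≱ k<i (subst (_≤ k) k∸y≡i (ℕ.m∸n≤m k y))
  miss (inj₂ N≤k∸i) y y<N k∸y≡i =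
    ℕ.<⇒≱ y<N (subst (N ≤_) (trans (cong (k ∸_) (sym k∸y≡i)) (ℕ.m∸[m∸n]≡n (ℕ.<⇒≤ (ℕ.<-≤-trans y<N N≤k)))) N≤k∸i)

≤⌊/2⌋⇒+≤ : ∀ k i → i ≤ ⌊ k /2⌋ → i +ℕ i ≤ k
≤⌊/2⌋⇒+≤ k             zero    _         = z≤n
≤⌊/2⌋⇒+≤ (suc (suc k)) (suc i) (s≤s i≤k/2) = s≤s (subst (_≤ suc k) (sym (ℕ.+-suc i i)) (s≤s (≤⌊/2⌋⇒+≤ k i i≤k/2)))

+≤⇒≤⌊/2⌋ : ∀ k i → i +ℕ i ≤ k → i ≤ ⌊ k /2⌋
+≤⇒≤⌊/2⌋ k             zero    _             = z≤n
+≤⇒≤⌊/2⌋ (suc zero)    (suc i) (s≤s 2i+1≤0) = contradiction (subst (_≤ 0) (ℕ.+-suc i i) 2i+1≤0) λ ()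
+≤⇒≤⌊/2⌋ (suc (suc k)) (suc i) (s≤s 2i+1≤k) = s≤s (+≤⇒≤⌊/2⌋ k i (ℕ.≤-pred (subst (_≤ suc k) (ℕ.+-suc i i) 2i+1≤k)))

1+⌊[k∸1]/2⌋≤k : ∀ {k} → 0 < k → suc ⌊ (k ∸ 1) /2⌋ ≤ k
1+⌊[k∸1]/2⌋≤k {suc k} _ = s≤s (ℕ.⌊n/2⌋≤n k)

module _ {k i : ℕ} (i≤k : i ≤ k) where

  private
    i+[k∸i]≡k : i +ℕ (k ∸ i) ≡ k
    i+[k∸i]≡k = ℕ.m+[n∸m]≡n i≤k

  i<k∸i⇒2i<k : i < k ∸ i → 2 *ℕ i < k
  i<k∸i⇒2i<k i<k∸i = subst₂ _<_ (cong (i +ℕ_) (sym (ℕ.+-identityʳ i))) i+[k∸i]≡k (ℕ.+-monoʳ-< i i<k∸i)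

  2i<k⇒i<k∸i : 2 *ℕ i < k → i < k ∸ i
  2i<k⇒i<k∸i 2i<k = ℕ.m+n≤o⇒m≤o∸n (suc i) (subst (λ x → suc x ≤ k) (cong (i +ℕ_) (ℕ.+-identityʳ i)) 2i<k)

  i≤k∸i⇒i≤⌊k/2⌋ : i ≤ k ∸ i → i ≤ ⌊ k /2⌋
  i≤k∸i⇒i≤⌊k/2⌋ i≤k∸i = +≤⇒≤⌊/2⌋ k i (subst (i +ℕ i ≤_) i+[k∸i]≡k (ℕ.+-monoʳ-≤ i i≤k∸i))

  k∸i<i⇒⌊k/2⌋<i : k ∸ i < i → ⌊ k /2⌋ < i
  k∸i<i⇒⌊k/2⌋<i k∸i<i = ℕ.≰⇒> (λ i≤⌊k/2⌋ → ℕ.<⇒≱ k∸i<i (ℕ.m+n≤o⇒m≤o∸n i (≤⌊/2⌋⇒+≤ k i i≤⌊k/2⌋)))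

  k∸i<i⇒k∸i≤⌊[k∸1]/2⌋ : k ∸ i < i → k ∸ i ≤ ⌊ (k ∸ 1) /2⌋
  k∸i<i⇒k∸i≤⌊[k∸1]/2⌋ k∸i<i = +≤⇒≤⌊/2⌋ (k ∸ 1) (k ∸ i)
    (ℕ.m+n≤o⇒m≤o∸n (k ∸ i +ℕ (k ∸ i))
      (subst (_≤ k) (ℕ.+-comm 1 _) (subst (k ∸ i +ℕ (k ∸ i) <_) i+[k∸i]≡k (ℕ.+-monoˡ-< (k ∸ i) k∸i<i))))

  i≤k∸i⇒⌊[k∸1]/2⌋<k∸i : 0 < k → i ≤ k ∸ i → ⌊ (k ∸ 1) /2⌋ < k ∸ i
  i≤k∸i⇒⌊[k∸1]/2⌋<k∸i 0<k i≤k∸i = ℕ.≰⇒> λ k∸i≤h → ℕ.<⇒≱ (double-bound k∸i≤h) (ℕ.+-monoˡ-≤ (k ∸ i) i≤k∸i)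
    where
    double-bound : k ∸ i ≤ ⌊ (k ∸ 1) /2⌋ → k ∸ i +ℕ (k ∸ i) < i +ℕ (k ∸ i)
    double-bound k∸i≤h = subst (k ∸ i +ℕ (k ∸ i) <_) (sym i+[k∸i]≡k)
                               (ℕ.≤-<-trans (≤⌊/2⌋⇒+≤ (k ∸ 1) (k ∸ i) k∸i≤h) (ℕ.∸-monoʳ-< (s≤s z≤n) 0<k))

coeff-formula-low : ∀ {k n i} → 0 < k → i ≤ k → i ≤ k ∸ i → coeff (formula k n) i ≡ binomTerm k n i
coeff-formula-low {k} {n} {i} 0<k i≤k i≤k∸i = begin
  coeff (formula k n) i
    ≡⟨ coeff-formula k n i ⟩
  Σ< (suc ⌊ k /2⌋) (λ x → coeff (monomial (binomTerm k n x) x) i)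
    + Σ< (suc ⌊ (k ∸ 1) /2⌋) (λ x → coeff (monomial (binomTerm k n x) (k ∸ x)) i)
    ≡⟨ cong₂ _+_ (Σ-monomials-id-hit (suc ⌊ k /2⌋) (binomTerm k n) (s≤s (i≤k∸i⇒i≤⌊k/2⌋ i≤k i≤k∸i)))
                 (Σ-monomials-rev-miss (suc ⌊ (k ∸ 1) /2⌋) k (binomTerm k n) (1+⌊[k∸1]/2⌋≤k 0<k)
                                       (inj₂ (i≤k∸i⇒⌊[k∸1]/2⌋<k∸i i≤k 0<k i≤k∸i))) ⟩
  binomTerm k n i + + 0
    ≡⟨ ℤ.+-identityʳ (binomTerm k n i) ⟩
  binomTerm k n i
    ∎
  where open ≡-Reasoning

coeff-formula-high : ∀ {k n i} → 0 < k → i ≤ k → k ∸ i < i → coeff (formula k n) i ≡ binomTerm k n (k ∸ i)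
coeff-formula-high {k} {n} {i} 0<k i≤k k∸i<i = begin
  coeff (formula k n) i
    ≡⟨ coeff-formula k n i ⟩
  Σ< (suc ⌊ k /2⌋) (λ x → coeff (monomial (binomTerm k n x) x) i)
    + Σ< (suc ⌊ (k ∸ 1) /2⌋) (λ x → coeff (monomial (binomTerm k n x) (k ∸ x)) i)
    ≡⟨ cong₂ _+_ (Σ-monomials-id-miss (suc ⌊ k /2⌋) (binomTerm k n) (k∸i<i⇒⌊k/2⌋<i i≤k k∸i<i))
                 (Σ-monomials-rev-hit (suc ⌊ (k ∸ 1) /2⌋) k (binomTerm k n) (1+⌊[k∸1]/2⌋≤k 0<k) i≤k
                                      (s≤s (k∸i<i⇒k∸i≤⌊[k∸1]/2⌋ i≤k k∸i<i))) ⟩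
  + 0 + binomTerm k n (k ∸ i)
    ≡⟨ ℤ.+-identityˡ (binomTerm k n (k ∸ i)) ⟩
  binomTerm k n (k ∸ i)
    ∎
  where open ≡-Reasoning

coeff-formula-beyond : ∀ {k n i} → 0 < k → k < i → coeff (formula k n) i ≡ + 0
coeff-formula-beyond {k} {n} {i} 0<k k<i = trans (coeff-formula k n i)
  (cong₂ _+_ (Σ-monomials-id-miss (suc ⌊ k /2⌋) (binomTerm k n) (ℕ.≤-<-trans (ℕ.⌊n/2⌋≤n k) k<i))
             (Σ-monomials-rev-miss (suc ⌊ (k ∸ 1) /2⌋) k (binomTerm k n) (1+⌊[k∸1]/2⌋≤k 0<k) (inj₁ k<i)))

Ŷ-terms+QU-low : ∀ {k n} i → 0 < k → k ≤ n → i < k ∸ i → sgn k * Σ< k (Ŷ-term n k i) + QU n k i ≡ binomTerm k n i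
Ŷ-terms+QU-low {k} {n} zero 0<k k≤n _ = begin
  sgn k * Σ< k (Ŷ-term n k 0) + QU n k 0
    ≡⟨ cong (λ z → sgn k * z + QU n k 0) (Σ-Ŷ-term-miss {n} {k} (λ j j<k k∸j≡0 → ℕ.<⇒≢ (ℕ.m<n⇒0<n∸m j<k) (sym k∸j≡0))) ⟩
  sgn k * + 0 + QU n k 0
    ≡⟨ trans (cong (_+ QU n k 0) (ℤ.*-zeroʳ (sgn k))) (ℤ.+-identityˡ (QU n k 0)) ⟩
  QU n k 0
    ≡⟨ QU≡binomTerm-0 0<k k≤n ⟩
  binomTerm k n 0
    ∎
  where open ≡-Reasoning
Ŷ-terms+QU-low {k} {n} i@(suc _) 0<k k≤n i<k∸i = begin
  sgn k * Σ< k (Ŷ-term n k i) + QU n k i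
    ≡⟨ cong₂ _+_ (sgn-Σ-Ŷ-term (s≤s z≤n) i≤k k≤n) (QU≡binomTerm-difference (s≤s z≤n) i<k k≤n) ⟩
  binomTerm k n (k ∸ i) + (binomTerm k n i - binomTerm k n (k ∸ i))
    ≡⟨ x+[y-x]≡y (binomTerm k n (k ∸ i)) (binomTerm k n i) ⟩
  binomTerm k n i
    ∎
  where
  open ≡-Reasoning
  i<k : i < k
  i<k = ℕ.<-≤-trans i<k∸i (ℕ.m∸n≤m k i)
  i≤k : i ≤ k
  i≤k = ℕ.<⇒≤ i<k
  x+[y-x]≡y : ∀ x y → x + (y - x) ≡ y
  x+[y-x]≡y = solve-∀

Ŷ-terms+QU≡formula : ∀ {k n} i → 0 < k → k ≤ n →
                     sgn k * Σ< k (Ŷ-term n k i) + (if 2 *ℕ i <ᵇ k then QU n k i else + 0) ≡ coeff (formula k n) i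
Ŷ-terms+QU≡formula {k} {n} i 0<k k≤n with i ℕ.≤? k
... | no i≰k = trans (cong₂ _+_ Ŷ-terms≡0 (if-false (<ᵇ-false 2i≮k))) (sym (coeff-formula-beyond 0<k (ℕ.≰⇒> i≰k)))
  where
  Ŷ-terms≡0 : sgn k * Σ< k (Ŷ-term n k i) ≡ + 0
  Ŷ-terms≡0 = trans (cong (sgn k *_) (Σ-Ŷ-term-miss (λ j _ k∸j≡i → i≰k (subst (_≤ k) k∸j≡i (ℕ.m∸n≤m k j)))))
                    (ℤ.*-zeroʳ (sgn k))
  2i≮k : ¬ 2 *ℕ i < k
  2i≮k 2i<k = i≰k (ℕ.≤-trans (ℕ.m≤n*m i 2) (ℕ.<⇒≤ 2i<k))
... | yes i≤k with ℕ.<-cmp i (k ∸ i)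
...   | tri< i<k∸i _ _ =
  trans (cong (λ z → sgn k * Σ< k (Ŷ-term n k i) + z) (if-true (<ᵇ-true (i<k∸i⇒2i<k i≤k i<k∸i))))
        (trans (Ŷ-terms+QU-low i 0<k k≤n i<k∸i) (sym (coeff-formula-low 0<k i≤k (ℕ.<⇒≤ i<k∸i))))
...   | tri≈ _ i≡k∸i _ =
  trans (cong₂ _+_ (sgn-Σ-Ŷ-term 0<i i≤k k≤n) (if-false (<ᵇ-false (ℕ.<-irrefl i≡k∸i ∘ 2i<k⇒i<k∸i i≤k))))
        (trans (ℤ.+-identityʳ _) (trans (cong (binomTerm k n) (sym i≡k∸i)) (sym (coeff-formula-low 0<k i≤k (ℕ.≤-reflexive i≡k∸i)))))
  where
  0<i : 0 < i
  0<i = ℕ.n≢0⇒n>0 (λ i≡0 → ℕ.<⇒≢ 0<k (trans (sym i≡0) (trans i≡k∸i (cong (k ∸_) i≡0))))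
...   | tri> _ _ k∸i<i =
  trans (cong₂ _+_ (sgn-Σ-Ŷ-term (ℕ.≤-<-trans z≤n k∸i<i) i≤k k≤n) (if-false (<ᵇ-false (ℕ.<⇒≯ k∸i<i ∘ 2i<k⇒i<k∸i i≤k))))
        (trans (ℤ.+-identityʳ _) (sym (coeff-formula-high 0<k i≤k k∸i<i)))

theorem1p1 : (Q : ∀ {N} → RawMatroid N → Poly) → IsInverseKL Q →
             ∀ (k n : ℕ) → 1 ≤ k → k ≤ n → Y Q (U k n) ≈ₚ formula k n
theorem1p1 Q Q-inverseKL k n 1≤k k≤n i = begin
  coeff (Y Q (U k n)) i
    ≡⟨ coeff-Y-uniform Q Q-inverseKL U-uniform i ⟩
  sgn k * Σ< k (Ŷ-term ∣ ⊤ {n} ∣ k i) + coeff (Q (U k n)) i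
    ≡⟨ cong (λ z → sgn k * Σ< k (Ŷ-term ∣ ⊤ {n} ∣ k i) + z) (coeff-Q-uniform Q Q-inverseKL U-uniform 1≤k i) ⟩
  sgn k * Σ< k (Ŷ-term ∣ ⊤ {n} ∣ k i) + (if 2 *ℕ i <ᵇ k then QU ∣ ⊤ {n} ∣ k i else + 0)
    ≡⟨ cong (λ m → sgn k * Σ< k (Ŷ-term m k i) + (if 2 *ℕ i <ᵇ k then QU m k i else + 0)) (∣⊤∣≡n n) ⟩
  sgn k * Σ< k (Ŷ-term n k i) + (if 2 *ℕ i <ᵇ k then QU n k i else + 0)
    ≡⟨ Ŷ-terms+QU≡formula i 1≤k k≤n ⟩
  coeff (formula k n) i
    ∎
  where
  open ≡-Reasoning
  U-uniform : IsUniform (U k n) k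
  U-uniform = U-isUniform k n 1≤k k≤n
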